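{- Let $q$ be a prime power, $n,r$ positive integers with $n\ge 2r+1$, and let $F$ be a subspace of $\mathbb F_q^n$ of dimension at most $r$. With the notation below, $P_F=E_F$.
   Context: Let $[k]_q=\frac{q^k-1}{q-1}$ (the number of lines in a $k$-dimensional space over $\mathbb F_q$), and index the coordinates of $\mathbb R^{[n]_q}$ by the lines ($1$-dimensional subspaces) $\ell$ of $\mathbb F_q^n$. For each $r$-dimensional subspace $S$ of $\mathbb F_q^n$ let $p_S\in\mathbb R^{[n]_q}$ have entries $(p_S)_\ell=[r]_q-[n]_q$ if $\ell\subseteq S$ and $(p_S)_\ell=[r]_q$ if $\ell\cap S=\{0\}$. For a subspace $F$ let $\mathbf 1_F$ be the vector with $(\mathbf 1_F)_\ell=1$ if $\ell\subseteq F$ and $0$ otherwise, $\mathbf 1$ the all-ones vector and $e_\ell$ the standard basis vectors. Define $P_F=\operatorname{span}(\{p_S: S\ r\text{ -dimensional},\ S\cap F=\{0\}\}\cup\{\mathbf 1\})$ and $E_F=\operatorname{span}(\{e_\ell:\ell\cap F=\{0\}\}\cup\{\mathbf 1_F\})$.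
   Formalization: The spans $P_F$ and $E_F$ are taken with rational coefficients, inside rational-valued vectors indexed by the lines, rather than in $\mathbb R^{[n]_q}$. -}

module Defs where

open import Level using (0ℓ)
open import Algebra.Bundles using (CommutativeRing)
open import Data.Nat as ℕ using (ℕ; zero; suc)
open import Data.Fin using (Fin)
open import Data.Bool using (Bool; true; false; if_then_else_)
open import Data.Product using (Σ; ∃; _×_; _,_; proj₁; proj₂)
open import Data.List as List using (List; []; _∷_)
open import Data.Vec as Vec using (Vec; []; _∷_; lookup)
open import Data.Rational as ℚ using (ℚ; 0ℚ; 1ℚ)
import Data.Integer as ℤ
open import Data.Bool.ListAction using (any)
open import Relation.Nullary using (¬_; Dec; yes; no; does)
open import Relation.Binary.Definitions using (Decidable)
open import Relation.Binary.PropositionalEquality using (_≡_)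

record FiniteField : Set₁ where
  field
    cring : CommutativeRing 0ℓ 0ℓ
  open CommutativeRing cring public
  field
    1≉0     : ¬ (1# ≈ 0#)
    inverse : ∀ x → ¬ (x ≈ 0#) → Σ Carrier (λ y → (x * y) ≈ 1#)
    _≟_     : Decidable _≈_
    q       : ℕ
    enum    : Vec Carrier q
    enum-complete  : ∀ x → Σ (Fin q) (λ i → lookup enum i ≈ x)
    enum-injective : ∀ i j → lookup enum i ≈ lookup enum j → i ≡ j

-- Gaussian number [k]_q = (q^k - 1)/(q - 1) = 1 + q + ... + q^(k-1)

gauss : ℕ → ℕ → ℕ
gauss q zero    = 0
gauss q (suc k) = 1 ℕ.+ q ℕ.* gauss q k

module LinAlg (K : FiniteField) (n : ℕ) where
  open FiniteField K

  V : Set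
  V = Vec Carrier n

  _≈v_ : V → V → Set
  u ≈v w = ∀ i → lookup u i ≈ lookup w i

  0v : V
  0v = Vec.replicate n 0#

  _·_ : Carrier → V → V
  c · v = Vec.map (c *_) v

  _+v_ : V → V → V
  _+v_ = Vec.zipWith _+_

  lincomb : ∀ {m} → Vec Carrier m → Vec V m → V
  lincomb []       []       = 0v
  lincomb (c ∷ cs) (b ∷ bs) = (c · b) +v lincomb cs bs

  -- a subspace is given by a basis: m linearly independent vectors
  LinIndep : ∀ {m} → Vec V m → Set
  LinIndep {m} B = ∀ (c : Vec Carrier m) → lincomb c B ≈v 0v → ∀ i → lookup c i ≈ 0#

  _∈⟨_⟩ : ∀ {m} → V → Vec V m → Set
  x ∈⟨ B ⟩ = Σ (Vec Carrier _) (λ c → lincomb c B ≈v x)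

  Disjoint : ∀ {m k} → Vec V m → Vec V k → Set
  Disjoint A B = ∀ x → x ∈⟨ A ⟩ → x ∈⟨ B ⟩ → x ≈v 0v

  NonZero : V → Set
  NonZero x = ¬ (x ≈v 0v)

  allVecs : (m : ℕ) → List (Vec Carrier m)
  allVecs zero    = [] ∷ []
  allVecs (suc m) = List.concatMap (λ c → List.map (c ∷_) (allVecs m)) (Vec.toList enum)

  _≈v?_ : V → V → Bool
  u ≈v? w = Vec.foldr _ (λ b acc → b Data.Bool.∧ acc) true (Vec.zipWith (λ a b → does (a ≟ b)) u w)

  memb : ∀ {m} → V → Vec V m → Bool
  memb {m} x B = any (λ c → lincomb c B ≈v? x) (allVecs m)

  -- Vectors of ℚ^{[n]_q} indexed by lines: a line ℓ = span{w} (w ≠ 0)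
  -- corresponds to the nonzero vectors in it; a vector indexed by lines is
  -- a function on V (only its values on nonzero vectors matter, and all the
  -- generators below are constant on lines).

  LVec : Set
  LVec = V → ℚ

  ind : Bool → ℚ
  ind b = if b then 1ℚ else 0ℚ

  pS : ∀ {r} → Vec V r → LVec
  pS {r} B x = if memb x B
                 then (ℤ.+ gauss q r ℚ./ 1) ℚ.- (ℤ.+ gauss q n ℚ./ 1)
                 else (ℤ.+ gauss q r ℚ./ 1)

  one : LVec
  one _ = 1ℚ

  eL : V → LVec
  eL w x = ind (memb x (w ∷ []))

  oneF : ∀ {k} → Vec V k → LVec
  oneF B x = ind (memb x B)

  lincombL : ∀ {I : Set} → (I → LVec) → List (ℚ × I) → LVec
  lincombL g []             x = 0ℚ
  lincombL g ((c , i) ∷ cs) x = c ℚ.* g i x ℚ.+ lincombL g cs x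

  InSpan : ∀ {I : Set} → (I → LVec) → LVec → Set
  InSpan {I} g v = Σ (List (ℚ × I)) (λ cs → ∀ x → NonZero x → v x ≡ lincombL g cs x)

  data PIdx (r : ℕ) {k : ℕ} (BF : Vec V k) : Set where
    pIdx   : (B : Vec V r) → LinIndep B → Disjoint B BF → PIdx r BF
    oneIdx : PIdx r BF

  PGen : ∀ r {k} (BF : Vec V k) → PIdx r BF → LVec
  PGen r BF (pIdx B _ _) = pS B
  PGen r BF oneIdx       = one

  data EIdx {k : ℕ} (BF : Vec V k) : Set where
    eIdx  : (w : V) → NonZero w → Disjoint (w ∷ []) BF → EIdx BF
    oneFIdx : EIdx BF

  EGen : ∀ {k} (BF : Vec V k) → EIdx BF → LVec
  EGen BF (eIdx w _ _) = eL w
  EGen BF oneFIdx      = oneF BF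

  P≡E : ℕ → ∀ {k} → Vec V k → Set
  P≡E r BF = (∀ v → InSpan (PGen r BF) v → InSpan (EGen BF) v)
           × (∀ v → InSpan (EGen BF) v → InSpan (PGen r BF) v)

{-# OPTIONS --safe #-}
module Submission where

-- P_F ⊆ E_F: the generators p_S (S ∩ F = 0) and 𝟏 are constant on lines and constant on the lines of F,
-- and every such function g equals g(F)·1_F + Σ_{ℓ ⊄ F} g(ℓ)·e_ℓ.
-- E_F ⊆ P_F: as p_S = [r]·𝟏 - [n]·1_S, the space P_F contains 1_S for every r-space S with S ∩ F = 0.
-- Since dim F ≤ r and n ≥ 2r + 1, a line ℓ ⊄ F extends to an (r+1)-space U with U ∩ F = 0.
-- Summing 1_H over all hyperplanes H of U gives [r]·1_U, and over those with ℓ ⊄ H it gives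
-- q^(r-1)·(1_U - e_ℓ); so e_ℓ ∈ P_F, and then also 1_F = 𝟏 - Σ_{ℓ ⊄ F} e_ℓ ∈ P_F.

open import Defs

import Algebra.Properties.CommutativeSemigroup as CommutativeSemigroupProperties
import Algebra.Properties.Ring as RingProperties
open import Data.Bool using (Bool; true; false; not; _∧_; if_then_else_)
open import Data.Bool.ListAction using (any)
open import Data.Bool.Properties using (¬-not; ∧-zeroʳ)
open import Data.Empty using (⊥-elim)
open import Data.Fin as Fin using (Fin)
import Data.Integer as ℤ
import Data.Integer.Properties as ℤ
open import Data.List as List using (List; []; _∷_; concatMap)
open import Data.Nat as ℕ using (ℕ; zero; suc; _≤_; _<_; z≤n; s≤s; _^_; _∸_)
import Data.Nat.Properties as ℕ
open import Data.Product as Product using (Σ; ∃; _×_; _,_; proj₁; proj₂)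
open import Data.Rational as ℚ using (ℚ; 0ℚ; 1ℚ)
import Data.Rational.Properties as ℚ
open import Data.Rational.Solver using (module +-*-Solver)
import Data.Rational.Unnormalised as ℚᵘ
import Data.Rational.Unnormalised.Properties as ℚᵘ
open import Data.Sum using (_⊎_; inj₁; inj₂; [_,_])
open import Data.Unit using (⊤; tt)
open import Data.Vec as Vec using (Vec; []; _∷_; lookup; _++_)
import Data.Vec.Properties as Vec
import Data.Vec.Relation.Binary.Equality.Setoid as VecEquality
open import Data.Vec.Relation.Binary.Pointwise.Inductive as Pointwise using ([]; _∷_)
open import Function using (_∘_; case_of_)
open import Function.Bundles using (_⇔_; mk⇔; Equivalence)
open import Relation.Binary.PropositionalEquality as ≡ using (_≡_; _≢_)
import Relation.Binary.Reasoning.Setoid as SetoidReasoning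
open import Relation.Nullary using (¬_; Dec; yes; no; does)
open import Relation.Nullary.Decidable using (does-⇔; dec-true; dec-false)

module Counting where
  open import Data.Nat using (_+_; _*_)
  open CommutativeSemigroupProperties ℕ.+-commutativeSemigroup using (interchange)
  open ≡ using (refl; sym; trans; cong; cong₂; subst; module ≡-Reasoning)

  private variable
    A B : Set

  𝟙 : Bool → ℕ
  𝟙 b = if b then 1 else 0

  ∑ : List A → (A → ℕ) → ℕ
  ∑ []       f = 0
  ∑ (x ∷ xs) f = f x + ∑ xs f

  infix 5 ∑
  syntax ∑ xs (λ x → e) = ∑[ x ∈ xs ] e

  count : (A → Bool) → List A → ℕ
  count p xs = ∑[ x ∈ xs ] 𝟙 (p x)

  𝟙-∧ : ∀ a b → 𝟙 (a ∧ b) ≡ 𝟙 a * 𝟙 b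
  𝟙-∧ true  b = sym (ℕ.+-identityʳ (𝟙 b))
  𝟙-∧ false b = refl

  true⇔true⇒≡ : ∀ {a b : Bool} → (a ≡ true → b ≡ true) → (b ≡ true → a ≡ true) → a ≡ b
  true⇔true⇒≡ {true}  {true}  _ _ = refl
  true⇔true⇒≡ {true}  {false} f _ = sym (f refl)
  true⇔true⇒≡ {false} {true}  _ g = g refl
  true⇔true⇒≡ {false} {false} _ _ = refl

  ∑-cong : ∀ {f g : A → ℕ} → (∀ x → f x ≡ g x) → ∀ xs → ∑ xs f ≡ ∑ xs g
  ∑-cong f≗g []       = refl
  ∑-cong f≗g (x ∷ xs) = cong₂ _+_ (f≗g x) (∑-cong f≗g xs)

  ∑-mono : ∀ {f g : A → ℕ} → (∀ x → f x ≤ g x) → ∀ xs → ∑ xs f ≤ ∑ xs g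
  ∑-mono f≤g []       = z≤n
  ∑-mono f≤g (x ∷ xs) = ℕ.+-mono-≤ (f≤g x) (∑-mono f≤g xs)

  ∑-zero : ∀ {f : A → ℕ} → (∀ x → f x ≡ 0) → ∀ xs → ∑ xs f ≡ 0
  ∑-zero f≗0 xs = trans (∑-cong f≗0 xs) (∑-const-0 xs)
    where
    ∑-const-0 : ∀ (xs : List A) → ∑[ x ∈ xs ] 0 ≡ 0
    ∑-const-0 []       = refl
    ∑-const-0 (_ ∷ xs) = ∑-const-0 xs

  ∑-++ : ∀ xs ys (f : A → ℕ) → ∑ (xs List.++ ys) f ≡ ∑ xs f + ∑ ys f
  ∑-++ []       ys f = refl
  ∑-++ (x ∷ xs) ys f = trans (cong (f x +_) (∑-++ xs ys f)) (sym (ℕ.+-assoc (f x) _ _))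

  ∑-map : ∀ (g : A → B) xs (f : B → ℕ) → ∑ (List.map g xs) f ≡ ∑ xs (f ∘ g)
  ∑-map g []       f = refl
  ∑-map g (x ∷ xs) f = cong (f (g x) +_) (∑-map g xs f)

  ∑-concatMap : ∀ (g : A → List B) xs (f : B → ℕ) →
                ∑ (concatMap g xs) f ≡ ∑[ x ∈ xs ] ∑ (g x) f
  ∑-concatMap g []       f = refl
  ∑-concatMap g (x ∷ xs) f =
    trans (∑-++ (g x) (concatMap g xs) f) (cong (∑ (g x) f +_) (∑-concatMap g xs f))

  ∑-+ : ∀ xs (f g : A → ℕ) → ∑[ x ∈ xs ] (f x + g x) ≡ ∑ xs f + ∑ xs g
  ∑-+ []       f g = refl
  ∑-+ (x ∷ xs) f g =
    trans (cong (f x + g x +_) (∑-+ xs f g)) (interchange (f x) (g x) (∑ xs f) (∑ xs g))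

  ∑-*ˡ : ∀ k xs (f : A → ℕ) → ∑[ x ∈ xs ] (k * f x) ≡ k * ∑ xs f
  ∑-*ˡ k []       f = sym (ℕ.*-zeroʳ k)
  ∑-*ˡ k (x ∷ xs) f = trans (cong (k * f x +_) (∑-*ˡ k xs f)) (sym (ℕ.*-distribˡ-+ k (f x) _))

  ∑-const : ∀ k (xs : List A) → ∑[ x ∈ xs ] k ≡ List.length xs * k
  ∑-const k []       = refl
  ∑-const k (x ∷ xs) = cong (k +_) (∑-const k xs)

  ∑-swap : ∀ xs ys (f : A → B → ℕ) → ∑[ x ∈ xs ] ∑ ys (f x) ≡ ∑[ y ∈ ys ] ∑[ x ∈ xs ] f x y
  ∑-swap []       ys f = sym (∑-zero (λ _ → refl) ys)
  ∑-swap (x ∷ xs) ys f = begin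
    ∑ ys (f x) + (∑[ x′ ∈ xs ] ∑ ys (f x′))        ≡⟨ cong (∑ ys (f x) +_) (∑-swap xs ys f) ⟩
    ∑ ys (f x) + (∑[ y ∈ ys ] ∑[ x′ ∈ xs ] f x′ y) ≡⟨ sym (∑-+ ys (f x) _) ⟩
    ∑[ y ∈ ys ] (f x y + (∑[ x′ ∈ xs ] f x′ y))    ∎
    where open ≡-Reasoning

  count-false : ∀ (p : A → Bool) xs → any p xs ≡ false → count p xs ≡ 0
  count-false p []       _ = refl
  count-false p (x ∷ xs) none with p x
  ... | false = count-false p xs none

  count-not : ∀ (p : A → Bool) xs → count p xs + count (not ∘ p) xs ≡ ∑[ _ ∈ xs ] 1
  count-not p []       = refl
  count-not p (x ∷ xs) with p x
  ... | true  = cong suc (count-not p xs)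
  ... | false = trans (ℕ.+-suc _ _) (cong suc (count-not p xs))

  implies-false : ∀ {a b : Bool} → (a ≡ true → b ≡ true) → b ≡ false → a ≡ false
  implies-false {false} _ _ = refl
  implies-false {true}  f b≡false with () ← trans (sym (f refl)) b≡false

  does-true : ∀ {X : Set} (X? : Dec X) → does X? ≡ true → X
  does-true (yes x) _ = x

  any-witness : ∀ (p : A → Bool) xs → any p xs ≡ true → ∃ λ x → p x ≡ true
  any-witness p (x ∷ xs) some with p x in px
  ... | true  = x , px
  ... | false = any-witness p xs some

  any-count : ∀ (p : A → Bool) xs → 1 ≤ count p xs → any p xs ≡ true
  any-count p xs 1≤count with any p xs in none
  ... | true  = refl
  ... | false with () ← subst (1 ≤_) (count-false p xs none) 1≤count

  gauss-suc : ∀ q m → gauss q (suc m) ≡ q ^ m + gauss q m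
  gauss-suc q zero    = cong suc (ℕ.*-zeroʳ q)
  gauss-suc q (suc m) = begin
    1 + q * gauss q (suc m)         ≡⟨ cong (λ g → 1 + q * g) (gauss-suc q m) ⟩
    1 + q * (q ^ m + gauss q m)     ≡⟨ cong (1 +_) (ℕ.*-distribˡ-+ q (q ^ m) (gauss q m)) ⟩
    suc (q ^ suc m + q * gauss q m) ≡⟨ sym (ℕ.+-suc (q ^ suc m) _) ⟩
    q ^ suc m + gauss q (suc m)     ∎
    where open ≡-Reasoning

  ∑Fin : ∀ k → (Fin k → ℕ) → ℕ
  ∑Fin zero    f = 0
  ∑Fin (suc k) f = f Fin.zero + ∑Fin k (f ∘ Fin.suc)

  ∑-toList : ∀ {k} (v : Vec A k) (f : A → ℕ) → ∑ (Vec.toList v) f ≡ ∑Fin k (f ∘ lookup v)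
  ∑-toList []      f = refl
  ∑-toList (x ∷ v) f = cong (f x +_) (∑-toList v f)

  ∑Fin-cong : ∀ k {f g : Fin k → ℕ} → (∀ i → f i ≡ g i) → ∑Fin k f ≡ ∑Fin k g
  ∑Fin-cong zero    f≗g = refl
  ∑Fin-cong (suc k) f≗g = cong₂ _+_ (f≗g Fin.zero) (∑Fin-cong k (f≗g ∘ Fin.suc))

  ∑Fin-δ : ∀ k (j : Fin k) → ∑Fin k (λ i → 𝟙 (does (i Fin.≟ j))) ≡ 1
  ∑Fin-δ (suc k) Fin.zero    = cong suc (∑Fin-zero k)
    where
    ∑Fin-zero : ∀ k → ∑Fin k (λ i → 𝟙 (does (Fin.suc i Fin.≟ Fin.zero {k}))) ≡ 0
    ∑Fin-zero zero    = refl
    ∑Fin-zero (suc k) = ∑Fin-zero k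
  ∑Fin-δ (suc k) (Fin.suc j) = trans (∑Fin-cong k same) (∑Fin-δ k j)
    where
    same : ∀ i → 𝟙 (does (Fin.suc i Fin.≟ Fin.suc j)) ≡ 𝟙 (does (i Fin.≟ j))
    same i with i Fin.≟ j
    ... | yes refl = refl
    ... | no _     = refl

open Counting

module Rationals where
  open import Data.Rational using (_+_; _*_; -_; _-_)
  open +-*-Solver using (solve; _:=_; _:+_; _:*_; _:-_; :-_; con)
  open ≡ using (refl; sym; trans; cong; cong₂; subst)

  private variable
    A : Set

  -- Opaque so that the type checker never unfolds the gcd normalisation inside _/_.
  opaque
    toℚ : ℕ → ℚ
    toℚ k = ℤ.+ k ℚ./ 1

    toℚ-def : ∀ k → toℚ k ≡ ℤ.+ k ℚ./ 1
    toℚ-def k = refl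

    toℚ-0 : toℚ 0 ≡ 0ℚ
    toℚ-0 = refl

    toℚ-1 : toℚ 1 ≡ 1ℚ
    toℚ-1 = refl

  toℚ-+ : ∀ a b → toℚ (a ℕ.+ b) ≡ toℚ a + toℚ b
  toℚ-+ a b = ℚ.toℚᵘ-injective (ℚᵘ.≃-trans (as-ℚᵘ (a ℕ.+ b)) (ℚᵘ.≃-sym (ℚᵘ.≃-trans
    (ℚ.toℚᵘ-homo-+ (toℚ a) (toℚ b)) (ℚᵘ.≃-trans (ℚᵘ.+-cong (as-ℚᵘ a) (as-ℚᵘ b)) (ℚᵘ.*≡* numerators)))))
    where
    as-ℚᵘ : ∀ k → ℚ.toℚᵘ (toℚ k) ℚᵘ.≃ ℚᵘ.mkℚᵘ (ℤ.+ k) 0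
    as-ℚᵘ k = subst (λ z → ℚ.toℚᵘ z ℚᵘ.≃ ℚᵘ.mkℚᵘ (ℤ.+ k) 0) (sym (toℚ-def k))
                    (ℚ.toℚᵘ-fromℚᵘ (ℚᵘ.mkℚᵘ (ℤ.+ k) 0))
    numerators : (ℤ.+ a ℤ.* ℤ.+ 1 ℤ.+ ℤ.+ b ℤ.* ℤ.+ 1) ℤ.* ℤ.+ 1 ≡ ℤ.+ (a ℕ.+ b) ℤ.* ℤ.+ 1
    numerators = trans (ℤ.*-identityʳ _) (trans (cong₂ ℤ._+_ (ℤ.*-identityʳ (ℤ.+ a)) (ℤ.*-identityʳ (ℤ.+ b)))
                   (trans (sym (ℤ.pos-+ a b)) (sym (ℤ.*-identityʳ _))))

  instance
    toℚ-suc-nonZero : ∀ {k} → ℚ.NonZero (toℚ (suc k))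
    toℚ-suc-nonZero {k} = subst ℚ.NonZero (sym (toℚ-def (suc k)))
                            (ℚ.pos⇒nonZero (ℤ.+ suc k ℚ./ 1) {{ℚ.normalize-pos (suc k) 1}})

  1/suc : ℕ → ℚ
  1/suc k = ℚ.1/ toℚ (suc k)

  1/suc-inverse : ∀ k → 1/suc k * toℚ (suc k) ≡ 1ℚ
  1/suc-inverse k = ℚ.*-inverseˡ (toℚ (suc k))

  𝟙ℚ : Bool → ℚ
  𝟙ℚ b = if b then 1ℚ else 0ℚ

  𝟙ℚ-𝟙 : ∀ b → 𝟙ℚ b ≡ toℚ (𝟙 b)
  𝟙ℚ-𝟙 true  = sym toℚ-1
  𝟙ℚ-𝟙 false = sym toℚ-0

  ∑ℚ : List A → (A → ℚ) → ℚ
  ∑ℚ []       f = 0ℚ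
  ∑ℚ (x ∷ xs) f = f x + ∑ℚ xs f

  ∑ℚ-cong : ∀ {f g : A → ℚ} → (∀ x → f x ≡ g x) → ∀ xs → ∑ℚ xs f ≡ ∑ℚ xs g
  ∑ℚ-cong f≗g []       = refl
  ∑ℚ-cong f≗g (x ∷ xs) = cong₂ _+_ (f≗g x) (∑ℚ-cong f≗g xs)

  ∑ℚ-count : ∀ c (p : A → Bool) xs → ∑ℚ xs (λ x → c * 𝟙ℚ (p x)) ≡ c * toℚ (count p xs)
  ∑ℚ-count c p []       = sym (trans (cong (c *_) toℚ-0) (ℚ.*-zeroʳ c))
  ∑ℚ-count c p (x ∷ xs) =
    trans (cong₂ _+_ (cong (c *_) (𝟙ℚ-𝟙 (p x))) (∑ℚ-count c p xs))
          (trans (sym (ℚ.*-distribˡ-+ c _ _)) (cong (c *_) (sym (toℚ-+ (𝟙 (p x)) _))))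

  scaleL : ∀ {I : Set} → ℚ → List (ℚ × I) → List (ℚ × I)
  scaleL s = List.map (λ (c , i) → s * c , i)

  reindex : ∀ {I J : Set} → (I → J) → List (ℚ × I) → List (ℚ × J)
  reindex f = List.map (λ (c , i) → c , f i)

  -- The value of β R·𝟏 - β·p_S at a line, in the form lincombL computes it.
  indicator-from-p : ∀ β R N → β * N ≡ 1ℚ → ∀ b →
                     𝟙ℚ b ≡ (β * R) * 1ℚ + (- β * (if b then R - N else R) + 0ℚ)
  indicator-from-p β R N βN≡1 true  = sym (trans
    (solve 3 (λ β R N → (β :* R) :* con 1ℚ :+ ((:- β) :* (R :- N) :+ con 0ℚ) := β :* N) refl β R N) βN≡1)
  indicator-from-p β R N βN≡1 false =
    sym (solve 2 (λ β R → (β :* R) :* con 1ℚ :+ ((:- β) :* R :+ con 0ℚ) := con 0ℚ) refl β R)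

open Rationals

module LinearAlgebra (K : FiniteField) where

  open FiniteField K hiding (zero)
  open RingProperties ring using (+-inverseˡ-unique; -‿involutive; -1*x≈-x)
  open CommutativeSemigroupProperties +-commutativeSemigroup using (interchange)
  open VecEquality setoid using (≋-refl; ≋-sym; ≋-trans; ≋-setoid)

  module ≋-Reasoning {n} = SetoidReasoning (≋-setoid n)

  -- Vectors over K

  _+v_ : ∀ {n} → Vec Carrier n → Vec Carrier n → Vec Carrier n
  _+v_ {n} = LinAlg._+v_ K n

  _·_ : ∀ {n} → Carrier → Vec Carrier n → Vec Carrier n
  _·_ {n} = LinAlg._·_ K n

  0v : ∀ {n} → Vec Carrier n
  0v {n} = LinAlg.0v K n

  -v_ : ∀ {n} → Vec Carrier n → Vec Carrier n
  -v_ = Vec.map (λ x → - x)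

  lincomb : ∀ {n m} → Vec Carrier m → Vec (Vec Carrier n) m → Vec Carrier n
  lincomb {n} = LinAlg.lincomb K n

  infix 4 _≋_
  _≋_ : ∀ {n} → Vec Carrier n → Vec Carrier n → Set
  _≋_ = VecEquality._≋_ setoid

  infixl 6 _+v_
  infixr 7 _·_
  infix  8 -v_

  ≈v⇒≋ : ∀ {n} {u w : Vec Carrier n} → (∀ i → lookup u i ≈ lookup w i) → u ≋ w
  ≈v⇒≋ {u = []}    {[]}    _   = []
  ≈v⇒≋ {u = _ ∷ _} {_ ∷ _} u≈w = u≈w Fin.zero ∷ ≈v⇒≋ (u≈w ∘ Fin.suc)

  +v-cong : ∀ {n} {a b c d : Vec Carrier n} → a ≋ b → c ≋ d → a +v c ≋ b +v d
  +v-cong []         []         = []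
  +v-cong (x≈y ∷ a≋b) (z≈w ∷ c≋d) = +-cong x≈y z≈w ∷ +v-cong a≋b c≋d

  ·-cong : ∀ {n} {s t} {a b : Vec Carrier n} → s ≈ t → a ≋ b → s · a ≋ t · b
  ·-cong s≈t []          = []
  ·-cong s≈t (x≈y ∷ a≋b) = *-cong s≈t x≈y ∷ ·-cong s≈t a≋b

  +v-comm : ∀ {n} (a b : Vec Carrier n) → a +v b ≋ b +v a
  +v-comm []      []      = []
  +v-comm (x ∷ a) (y ∷ b) = +-comm x y ∷ +v-comm a b

  +v-assoc : ∀ {n} (a b c : Vec Carrier n) → (a +v b) +v c ≋ a +v (b +v c)
  +v-assoc []      []      []      = []
  +v-assoc (x ∷ a) (y ∷ b) (z ∷ c) = +-assoc x y z ∷ +v-assoc a b c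

  +v-interchange : ∀ {n} (a b c d : Vec Carrier n) → (a +v b) +v (c +v d) ≋ (a +v c) +v (b +v d)
  +v-interchange []      []      []      []      = []
  +v-interchange (x ∷ a) (y ∷ b) (z ∷ c) (w ∷ d) = interchange x y z w ∷ +v-interchange a b c d

  +v-identityˡ : ∀ {n} (a : Vec Carrier n) → 0v +v a ≋ a
  +v-identityˡ []      = []
  +v-identityˡ (x ∷ a) = +-identityˡ x ∷ +v-identityˡ a

  +v-identityʳ : ∀ {n} (a : Vec Carrier n) → a +v 0v ≋ a
  +v-identityʳ []      = []
  +v-identityʳ (x ∷ a) = +-identityʳ x ∷ +v-identityʳ a

  +v-inverseʳ : ∀ {n} (a : Vec Carrier n) → a +v -v a ≋ 0v
  +v-inverseʳ []      = []
  +v-inverseʳ (x ∷ a) = -‿inverseʳ x ∷ +v-inverseʳ a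

  +v-inverseˡ-unique : ∀ {n} (a b : Vec Carrier n) → a +v b ≋ 0v → a ≋ -v b
  +v-inverseˡ-unique []      []      []           = []
  +v-inverseˡ-unique (x ∷ a) (y ∷ b) (x+y≈0 ∷ eq) = +-inverseˡ-unique x y x+y≈0 ∷ +v-inverseˡ-unique a b eq

  -v-involutive : ∀ {n} (a : Vec Carrier n) → -v -v a ≋ a
  -v-involutive []      = []
  -v-involutive (x ∷ a) = -‿involutive x ∷ -v-involutive a

  -v-cong : ∀ {n} {a b : Vec Carrier n} → a ≋ b → -v a ≋ -v b
  -v-cong []          = []
  -v-cong (x≈y ∷ a≋b) = -‿cong x≈y ∷ -v-cong a≋b

  ·-distribˡ : ∀ {n} s (a b : Vec Carrier n) → s · (a +v b) ≋ s · a +v s · b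
  ·-distribˡ s []      []      = []
  ·-distribˡ s (x ∷ a) (y ∷ b) = distribˡ s x y ∷ ·-distribˡ s a b

  ·-distribʳ : ∀ {n} s t (a : Vec Carrier n) → (s + t) · a ≋ s · a +v t · a
  ·-distribʳ s t []      = []
  ·-distribʳ s t (x ∷ a) = distribʳ x s t ∷ ·-distribʳ s t a

  ·-assoc : ∀ {n} s t (a : Vec Carrier n) → s · (t · a) ≋ (s * t) · a
  ·-assoc s t []      = []
  ·-assoc s t (x ∷ a) = sym (*-assoc s t x) ∷ ·-assoc s t a

  ·-zeroˡ : ∀ {n} (a : Vec Carrier n) → 0# · a ≋ 0v
  ·-zeroˡ []      = []
  ·-zeroˡ (x ∷ a) = zeroˡ x ∷ ·-zeroˡ a

  ·-zeroʳ : ∀ {n} s → s · 0v ≋ 0v {n}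
  ·-zeroʳ {zero}  s = []
  ·-zeroʳ {suc n} s = zeroʳ s ∷ ·-zeroʳ s

  ·-identityˡ : ∀ {n} (a : Vec Carrier n) → 1# · a ≋ a
  ·-identityˡ []      = []
  ·-identityˡ (x ∷ a) = *-identityˡ x ∷ ·-identityˡ a

  -v≋-1· : ∀ {n} (a : Vec Carrier n) → -v a ≋ (- 1#) · a
  -v≋-1· []      = []
  -v≋-1· (x ∷ a) = sym (-1*x≈-x x) ∷ -v≋-1· a

  inv : ∀ {c} → ¬ c ≈ 0# → Carrier
  inv {c} c≉0 = proj₁ (inverse c c≉0)

  inv-cancelˡ : ∀ {a} (a≉0 : ¬ a ≈ 0#) c → inv a≉0 * (a * c) ≈ c
  inv-cancelˡ {a} a≉0 c = begin
    inv a≉0 * (a * c) ≈⟨ sym (*-assoc _ a c) ⟩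
    (inv a≉0 * a) * c ≈⟨ *-congʳ (trans (*-comm _ a) (proj₂ (inverse a a≉0))) ⟩
    1# * c            ≈⟨ *-identityˡ c ⟩
    c                 ∎
    where open SetoidReasoning setoid

  inv-cancelʳ : ∀ {a} (a≉0 : ¬ a ≈ 0#) c → a * (inv a≉0 * c) ≈ c
  inv-cancelʳ {a} a≉0 c = begin
    a * (inv a≉0 * c) ≈⟨ sym (*-assoc a _ c) ⟩
    (a * inv a≉0) * c ≈⟨ *-congʳ (proj₂ (inverse a a≉0)) ⟩
    1# * c            ≈⟨ *-identityˡ c ⟩
    c                 ∎
    where open SetoidReasoning setoid

  solve-*ˡ : ∀ {a} (a≉0 : ¬ a ≈ 0#) t c → (t ≈ a * c) ⇔ (c ≈ inv a≉0 * t)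
  solve-*ˡ a≉0 t c = mk⇔ (λ t≈ac → trans (sym (inv-cancelˡ a≉0 c)) (*-congˡ (sym t≈ac)))
                         (λ c≈ → trans (sym (inv-cancelʳ a≉0 t)) (*-congˡ (sym c≈)))

  solve-+ˡ : ∀ t a d → (t ≈ a + d) ⇔ (t - a ≈ d)
  solve-+ˡ t a d = mk⇔ to from
    where
    open SetoidReasoning setoid
    to : t ≈ a + d → t - a ≈ d
    to t≈a+d = begin
      t - a       ≈⟨ +-congʳ t≈a+d ⟩
      (a + d) - a ≈⟨ +-congʳ (+-comm a d) ⟩
      (d + a) - a ≈⟨ +-assoc d a (- a) ⟩
      d + (a - a) ≈⟨ +-congˡ (-‿inverseʳ a) ⟩
      d + 0#      ≈⟨ +-identityʳ d ⟩
      d           ∎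
    from : t - a ≈ d → t ≈ a + d
    from t-a≈d = begin
      t             ≈⟨ sym (+-identityˡ t) ⟩
      0# + t        ≈⟨ +-congʳ (sym (-‿inverseʳ a)) ⟩
      (a - a) + t   ≈⟨ +-assoc a (- a) t ⟩
      a + (- a + t) ≈⟨ +-congˡ (+-comm (- a) t) ⟩
      a + (t - a)   ≈⟨ +-congˡ t-a≈d ⟩
      a + d         ∎

  ·-inverseˡ : ∀ {n c} (c≉0 : ¬ c ≈ 0#) (w : Vec Carrier n) → inv c≉0 · (c · w) ≋ w
  ·-inverseˡ c≉0 []      = []
  ·-inverseˡ c≉0 (x ∷ w) = inv-cancelˡ c≉0 x ∷ ·-inverseˡ c≉0 w

  lincomb-cong : ∀ {n m} {c d : Vec Carrier m} (B : Vec (Vec Carrier n) m) → c ≋ d → lincomb c B ≋ lincomb d B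
  lincomb-cong []      []          = ≋-refl
  lincomb-cong (b ∷ B) (x≈y ∷ c≋d) = +v-cong (·-cong x≈y ≋-refl) (lincomb-cong B c≋d)

  lincomb-0v : ∀ {n m} (B : Vec (Vec Carrier n) m) → lincomb 0v B ≋ 0v
  lincomb-0v []      = ≋-refl
  lincomb-0v (b ∷ B) = ≋-trans (+v-cong (·-zeroˡ b) (lincomb-0v B)) (+v-identityˡ 0v)

  lincomb-+v : ∀ {n m} (c d : Vec Carrier m) (B : Vec (Vec Carrier n) m) →
               lincomb (c +v d) B ≋ lincomb c B +v lincomb d B
  lincomb-+v []      []      []      = ≋-sym (+v-identityˡ 0v)
  lincomb-+v (x ∷ c) (y ∷ d) (b ∷ B) =
    ≋-trans (+v-cong (·-distribʳ x y b) (lincomb-+v c d B)) (+v-interchange _ _ _ _)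

  lincomb-· : ∀ {n m} s (c : Vec Carrier m) (B : Vec (Vec Carrier n) m) →
              lincomb (s · c) B ≋ s · lincomb c B
  lincomb-· s []      []      = ≋-sym (·-zeroʳ s)
  lincomb-· s (x ∷ c) (b ∷ B) =
    ≋-trans (+v-cong (≋-sym (·-assoc s x b)) (lincomb-· s c B)) (≋-sym (·-distribˡ s _ _))

  lincomb-neg : ∀ {n m} (c : Vec Carrier m) (B : Vec (Vec Carrier n) m) →
               lincomb (-v c) B ≋ -v lincomb c B
  lincomb-neg c B = ≋-trans (lincomb-cong B (-v≋-1· c))
                           (≋-trans (lincomb-· (- 1#) c B) (≋-sym (-v≋-1· _)))

  lincomb-++ : ∀ {n m k} (c : Vec Carrier m) (d : Vec Carrier k) B (C : Vec (Vec Carrier n) k) →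
               lincomb (c ++ d) (B ++ C) ≋ lincomb c B +v lincomb d C
  lincomb-++ []      d []      C = ≋-sym (+v-identityˡ _)
  lincomb-++ (x ∷ c) d (b ∷ B) C =
    ≋-trans (+v-cong ≋-refl (lincomb-++ c d B C)) (≋-sym (+v-assoc _ _ _))

  lincomb-lincomb : ∀ {n N m} (c : Vec Carrier m) (M : Vec (Vec Carrier N) m) (B : Vec (Vec Carrier n) N) →
                    lincomb c (Vec.map (λ y → lincomb y B) M) ≋ lincomb (lincomb c M) B
  lincomb-lincomb []      []      B = ≋-sym (lincomb-0v B)
  lincomb-lincomb (x ∷ c) (y ∷ M) B =
    ≋-trans (+v-cong (≋-sym (lincomb-· x y B)) (lincomb-lincomb c M B))
            (≋-sym (lincomb-+v (x · y) (lincomb c M) B))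

  -- Enumeration of K^m and span membership

  -- allVecs ignores the ambient dimension of LinAlg, so any instance will do.
  vectors : ∀ m → List (Vec Carrier m)
  vectors = LinAlg.allVecs K 0

  allVecs≡vectors : ∀ n m → LinAlg.allVecs K n m ≡ vectors m
  allVecs≡vectors n zero    = ≡.refl
  allVecs≡vectors n (suc m) =
    ≡.cong (λ vs → List.concatMap (λ c → List.map (c ∷_) vs) (Vec.toList enum)) (allVecs≡vectors n m)

  enum-δ : ∀ s → count (λ c → does (c ≟ s)) (Vec.toList enum) ≡ 1
  enum-δ s = ≡.trans (∑-toList enum _) (≡.trans (∑Fin-cong q same-index) (∑Fin-δ q i))
    where
    i = proj₁ (enum-complete s)
    same-index : ∀ j → 𝟙 (does (lookup enum j ≟ s)) ≡ 𝟙 (does (j Fin.≟ i))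
    same-index j = ≡.cong 𝟙 (does-⇔ (mk⇔ (λ e → enum-injective j i (trans e (sym (proj₂ (enum-complete s)))))
                                          (λ { ≡.refl → proj₂ (enum-complete s) }))
                                     (lookup enum j ≟ s) (j Fin.≟ i))

  ∑-enum-const : ∀ k → ∑[ _ ∈ Vec.toList enum ] k ≡ q ℕ.* k
  ∑-enum-const k = ≡.trans (∑-const k (Vec.toList enum)) (≡.cong (ℕ._* k) (Vec.length-toList enum))

  ∑-vectors-suc : ∀ m (f : Vec Carrier (suc m) → ℕ) →
                  ∑ (vectors (suc m)) f ≡ ∑[ c ∈ Vec.toList enum ] ∑[ b ∈ vectors m ] f (c ∷ b)
  ∑-vectors-suc m f = ≡.trans (∑-concatMap (λ c → List.map (c ∷_) (vectors m)) (Vec.toList enum) f)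
                              (∑-cong (λ c → ∑-map (c ∷_) (vectors m) f) (Vec.toList enum))

  _≈v?_ : ∀ {n} → Vec Carrier n → Vec Carrier n → Bool
  _≈v?_ {n} = LinAlg._≈v?_ K n

  ≈v?-sound : ∀ {n} (u w : Vec Carrier n) → u ≈v? w ≡ true → u ≋ w
  ≈v?-sound []      []      _ = []
  ≈v?-sound (a ∷ u) (b ∷ w) e with a ≟ b
  ... | yes a≈b = a≈b ∷ ≈v?-sound u w e

  ≈v?-complete : ∀ {n} (u w : Vec Carrier n) → u ≋ w → u ≈v? w ≡ true
  ≈v?-complete []      []      _             = ≡.refl
  ≈v?-complete (a ∷ u) (b ∷ w) (a≈b ∷ u≋w) with a ≟ b
  ... | yes _   = ≈v?-complete u w u≋w
  ... | no a≉b  = ⊥-elim (a≉b a≈b)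

  ≈v?-ext : ∀ {m n} {u w : Vec Carrier m} {u′ w′ : Vec Carrier n} →
            (u ≋ w → u′ ≋ w′) → (u′ ≋ w′ → u ≋ w) → u ≈v? w ≡ u′ ≈v? w′
  ≈v?-ext {u = u} {w} {u′} {w′} f g =
    true⇔true⇒≡ (≈v?-complete u′ w′ ∘ f ∘ ≈v?-sound u w) (≈v?-complete u w ∘ g ∘ ≈v?-sound u′ w′)

  ≈v?-sym : ∀ {n} (u w : Vec Carrier n) → u ≈v? w ≡ w ≈v? u
  ≈v?-sym u w = ≈v?-ext {u = u} {w} {w} {u} ≋-sym ≋-sym

  vectors-δ : ∀ m (z : Vec Carrier m) → count (_≈v? z) (vectors m) ≡ 1
  vectors-δ zero    []       = ≡.refl
  vectors-δ (suc m) (z ∷ zs) = begin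
    count (_≈v? (z ∷ zs)) (vectors (suc m))
      ≡⟨ ∑-vectors-suc m _ ⟩
    ∑[ c ∈ Vec.toList enum ] ∑[ b ∈ vectors m ] 𝟙 (does (c ≟ z) ∧ (b ≈v? zs))
      ≡⟨ ∑-cong first-coordinate (Vec.toList enum) ⟩
    count (λ c → does (c ≟ z)) (Vec.toList enum)
      ≡⟨ enum-δ z ⟩
    1 ∎
    where
    open ≡.≡-Reasoning
    first-coordinate : ∀ c → ∑[ b ∈ vectors m ] 𝟙 (does (c ≟ z) ∧ (b ≈v? zs)) ≡ 𝟙 (does (c ≟ z))
    first-coordinate c = begin
      ∑[ b ∈ vectors m ] 𝟙 (does (c ≟ z) ∧ (b ≈v? zs))       ≡⟨ ∑-cong (λ b → 𝟙-∧ (does (c ≟ z)) (b ≈v? zs)) (vectors m) ⟩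
      ∑[ b ∈ vectors m ] (𝟙 (does (c ≟ z)) ℕ.* 𝟙 (b ≈v? zs)) ≡⟨ ∑-*ˡ (𝟙 (does (c ≟ z))) (vectors m) _ ⟩
      𝟙 (does (c ≟ z)) ℕ.* count (_≈v? zs) (vectors m)       ≡⟨ ≡.cong (𝟙 (does (c ≟ z)) ℕ.*_) (vectors-δ m zs) ⟩
      𝟙 (does (c ≟ z)) ℕ.* 1                                 ≡⟨ ℕ.*-identityʳ _ ⟩
      𝟙 (does (c ≟ z))                                       ∎

  ∑-vectors-const : ∀ m k → ∑[ _ ∈ vectors m ] k ≡ q ^ m ℕ.* k
  ∑-vectors-const zero    k = ≡.refl
  ∑-vectors-const (suc m) k = begin
    ∑[ _ ∈ vectors (suc m) ] k                      ≡⟨ ∑-vectors-suc m _ ⟩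
    ∑[ _ ∈ Vec.toList enum ] (∑[ _ ∈ vectors m ] k) ≡⟨ ∑-cong (λ _ → ∑-vectors-const m k) (Vec.toList enum) ⟩
    ∑[ _ ∈ Vec.toList enum ] (q ^ m ℕ.* k)          ≡⟨ ∑-enum-const (q ^ m ℕ.* k) ⟩
    q ℕ.* (q ^ m ℕ.* k)                             ≡⟨ ≡.sym (ℕ.*-assoc q (q ^ m) k) ⟩
    q ^ suc m ℕ.* k                                 ∎
    where open ≡.≡-Reasoning

  vectors-size : ∀ m → ∑[ _ ∈ vectors m ] 1 ≡ q ^ m
  vectors-size m = ≡.trans (∑-vectors-const m 1) (ℕ.*-identityʳ (q ^ m))

  2≤q : 2 ≤ q
  2≤q = distinct⇒2≤ (proj₁ (enum-complete 0#)) (proj₁ (enum-complete 1#)) indices-differ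
    where
    indices-differ : proj₁ (enum-complete 0#) ≢ proj₁ (enum-complete 1#)
    indices-differ eq = 1≉0 (trans (sym (proj₂ (enum-complete 1#)))
      (trans (reflexive (≡.cong (lookup enum) (≡.sym eq))) (proj₂ (enum-complete 0#))))
    distinct⇒2≤ : ∀ {k} (i j : Fin k) → i ≢ j → 2 ≤ k
    distinct⇒2≤ {suc zero}    Fin.zero Fin.zero i≢j = ⊥-elim (i≢j ≡.refl)
    distinct⇒2≤ {suc (suc k)} _        _        _   = s≤s (s≤s z≤n)

  suc-pred-q^ : ∀ j → suc (ℕ.pred (q ^ j)) ≡ q ^ j
  suc-pred-q^ j = ℕ.suc-pred (q ^ j) {{ℕ.m^n≢0 q j {{ℕ.>-nonZero (ℕ.<-≤-trans (s≤s z≤n) 2≤q)}}}}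

  vectors-complete : ∀ {m} (z : Vec Carrier m) (p : Vec Carrier m → Bool) →
                     (∀ c → c ≋ z → p c ≡ true) → any p (vectors m) ≡ true
  vectors-complete {m} z p p-on-z = any-count p (vectors m)
    (≡.subst (_≤ count p (vectors m)) (vectors-δ m z) (∑-mono z≤p (vectors m)))
    where
    z≤p : ∀ c → 𝟙 (c ≈v? z) ≤ 𝟙 (p c)
    z≤p c with c ≈v? z in c≈z
    ... | false = z≤n
    ... | true  = ≡.subst (λ b → 1 ≤ 𝟙 b) (≡.sym (p-on-z c (≈v?-sound c z c≈z))) (s≤s z≤n)

  infix 4 _∈span_
  _∈span_ : ∀ {n m} → Vec Carrier n → Vec (Vec Carrier n) m → Set
  x ∈span B = ∃ λ c → lincomb c B ≋ x

  memb : ∀ {n m} → Vec Carrier n → Vec (Vec Carrier n) m → Bool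
  memb {n} = LinAlg.memb K n

  memb-sound : ∀ {n m} x (B : Vec (Vec Carrier n) m) → memb x B ≡ true → x ∈span B
  memb-sound {n} {m} x B e with any-witness _ (LinAlg.allVecs K n m) e
  ... | c , c-ok = c , ≈v?-sound _ _ c-ok

  memb-complete : ∀ {n m} x (B : Vec (Vec Carrier n) m) → x ∈span B → memb x B ≡ true
  memb-complete {n} {m} x B (c , c-ok) =
    ≡.subst (λ vs → any (λ c′ → lincomb c′ B ≈v? x) vs ≡ true) (≡.sym (allVecs≡vectors n m))
            (vectors-complete c _ (λ c′ c′≋c → ≈v?-complete _ _ (≋-trans (lincomb-cong B c′≋c) c-ok)))

  memb-ext : ∀ {n n′ m k} x y (B : Vec (Vec Carrier n) m) (C : Vec (Vec Carrier n′) k) →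
             (x ∈span B → y ∈span C) → (y ∈span C → x ∈span B) → memb x B ≡ memb y C
  memb-ext x y B C f g =
    true⇔true⇒≡ (memb-complete y C ∘ f ∘ memb-sound x B) (memb-complete x B ∘ g ∘ memb-sound y C)

  -- Linear independence

  Independent : ∀ {n m} → Vec (Vec Carrier n) m → Set
  Independent B = ∀ c → lincomb c B ≋ 0v → c ≋ 0v

  lookup-0v : ∀ {n} (i : Fin n) → lookup (0v {n}) i ≈ 0#
  lookup-0v i = reflexive (Vec.lookup-replicate i 0#)

  LinIndep⇒Independent : ∀ {n m} (B : Vec (Vec Carrier n) m) → LinAlg.LinIndep K n B → Independent B
  LinIndep⇒Independent B indep c c-ok =
    ≈v⇒≋ (λ i → trans (indep c (Pointwise.lookup c-ok) i) (sym (lookup-0v i)))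

  Independent⇒LinIndep : ∀ {n m} (B : Vec (Vec Carrier n) m) → Independent B → LinAlg.LinIndep K n B
  Independent⇒LinIndep B indep c c-ok i =
    trans (Pointwise.lookup (indep c (≈v⇒≋ c-ok)) i) (lookup-0v i)

  independent-unique : ∀ {n m} {B : Vec (Vec Carrier n) m} → Independent B →
                       ∀ c d → lincomb c B ≋ lincomb d B → c ≋ d
  independent-unique {B = B} indep c d same =
    ≋-trans (+v-inverseˡ-unique c (-v d) (indep (c +v -v d) difference)) (-v-involutive d)
    where
    difference : lincomb (c +v -v d) B ≋ 0v
    difference = ≋-trans (lincomb-+v c (-v d) B)
                   (≋-trans (+v-cong same (lincomb-neg d B)) (+v-inverseʳ (lincomb d B)))

  independent-∷ : ∀ {n m} {B : Vec (Vec Carrier n) m} v → Independent B → ¬ v ∈span B → Independent (v ∷ B)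
  independent-∷ {B = B} v indep v∉B (c₀ ∷ c) eq with c₀ ≟ 0#
  ... | yes c₀≈0 = c₀≈0 ∷ indep c rest≋0
    where
    rest≋0 : lincomb c B ≋ 0v
    rest≋0 = ≋-trans (≋-sym (+v-identityˡ _))
               (≋-trans (+v-cong (≋-sym (≋-trans (·-cong c₀≈0 ≋-refl) (·-zeroˡ v))) ≋-refl) eq)
  ... | no c₀≉0 = ⊥-elim (v∉B (inv c₀≉0 · -v c , v∈B))
    where
    open ≋-Reasoning
    v∈B : lincomb (inv c₀≉0 · -v c) B ≋ v
    v∈B = begin
      lincomb (inv c₀≉0 · -v c) B ≈⟨ lincomb-· _ (-v c) B ⟩
      inv c₀≉0 · lincomb (-v c) B ≈⟨ ·-cong refl (lincomb-neg c B) ⟩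
      inv c₀≉0 · -v lincomb c B   ≈⟨ ·-cong refl (≋-sym (+v-inverseˡ-unique _ _ eq)) ⟩
      inv c₀≉0 · (c₀ · v)         ≈⟨ ·-inverseˡ c₀≉0 v ⟩
      v                           ∎

  independent-swap : ∀ {n m} {B : Vec (Vec Carrier n) m} a b → Independent (a ∷ b ∷ B) → Independent (b ∷ a ∷ B)
  independent-swap {B = B} a b indep (x ∷ y ∷ c) eq with indep (y ∷ x ∷ c) swapped
    where
    swapped : lincomb (y ∷ x ∷ c) (a ∷ b ∷ B) ≋ 0v
    swapped = ≋-trans (≋-trans (≋-sym (+v-assoc (y · a) (x · b) _))
                (≋-trans (+v-cong (+v-comm (y · a) (x · b)) ≋-refl) (+v-assoc (x · b) (y · a) _))) eq
  ... | y≈0 ∷ x≈0 ∷ c≋0 = x≈0 ∷ y≈0 ∷ c≋0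

  ++-≋0v⁻ : ∀ {a b} (u : Vec Carrier a) (v : Vec Carrier b) → u ++ v ≋ 0v → u ≋ 0v × v ≋ 0v
  ++-≋0v⁻ []      v uv≋0          = [] , uv≋0
  ++-≋0v⁻ (x ∷ u) v (x≈0 ∷ uv≋0) with ++-≋0v⁻ u v uv≋0
  ... | u≋0 , v≋0 = x≈0 ∷ u≋0 , v≋0

  independent-++ˡ : ∀ {n a b} (A : Vec (Vec Carrier n) a) (B : Vec (Vec Carrier n) b) →
                    Independent (A ++ B) → Independent A
  independent-++ˡ A B indep c eq = proj₁ (++-≋0v⁻ c 0v (indep (c ++ 0v)
    (≋-trans (lincomb-++ c 0v A B) (≋-trans (+v-cong eq (lincomb-0v B)) (+v-identityˡ 0v)))))

  image : ∀ {n N m} → Vec (Vec Carrier n) N → Vec (Vec Carrier N) m → Vec (Vec Carrier n) m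
  image us M = Vec.map (λ y → lincomb y us) M

  ∈span-image : ∀ {n N m} (us : Vec (Vec Carrier n) N) (M : Vec (Vec Carrier N) m) {x} →
                x ∈span image us M → x ∈span us
  ∈span-image us M (c , c-ok) = lincomb c M , ≋-trans (≋-sym (lincomb-lincomb c M us)) c-ok

  independent-image : ∀ {n N m} {us : Vec (Vec Carrier n) N} {M : Vec (Vec Carrier N) m} →
                      Independent us → Independent M → Independent (image us M)
  independent-image {us = us} {M} us-indep M-indep c eq =
    M-indep c (us-indep (lincomb c M) (≋-trans (≋-sym (lincomb-lincomb c M us)) eq))

  independent-++-disjoint : ∀ {n a b} (A : Vec (Vec Carrier n) a) (B : Vec (Vec Carrier n) b) →
                            Independent (A ++ B) → ∀ {x} → x ∈span A → x ∈span B → x ≋ 0v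
  independent-++-disjoint A B indep {x} (c , c-ok) (d , d-ok) =
    ≋-trans (≋-sym c-ok) (≋-trans (lincomb-cong A c≋0) (lincomb-0v A))
    where
    combination≋0 : lincomb (c ++ -v d) (A ++ B) ≋ 0v
    combination≋0 = ≋-trans (lincomb-++ c (-v d) A B)
      (≋-trans (+v-cong c-ok (≋-trans (lincomb-neg d B) (-v-cong d-ok))) (+v-inverseʳ x))
    c≋0 : c ≋ 0v
    c≋0 = proj₁ (++-≋0v⁻ c (-v d) (indep _ combination≋0))

  memb-image : ∀ {n N m} {us : Vec (Vec Carrier n) N} (M : Vec (Vec Carrier N) m) → Independent us →
               ∀ {x} y → lincomb y us ≋ x → memb x (image us M) ≡ memb y M
  memb-image {us = us} M us-indep {x} y y-ok = memb-ext x y (image us M) M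
    (λ (c , c-ok) → c , independent-unique us-indep (lincomb c M) y
                          (≋-trans (≋-sym (lincomb-lincomb c M us)) (≋-trans c-ok (≋-sym y-ok))))
    (λ (c , c-ok) → c , ≋-trans (lincomb-lincomb c M us) (≋-trans (lincomb-cong us c-ok) y-ok))

  memb-image-outside : ∀ {n N m} (us : Vec (Vec Carrier n) N) (M : Vec (Vec Carrier N) m) {x} →
                       memb x us ≡ false → memb x (image us M) ≡ false
  memb-image-outside us M {x} = implies-false (memb-complete x us ∘ ∈span-image us M ∘ memb-sound x (image us M))

  span-size : ∀ {n m} (B : Vec (Vec Carrier n) m) → Independent B → count (λ w → memb w B) (vectors n) ≡ q ^ m
  span-size {n} {m} B indep = begin
    count (λ w → memb w B) (vectors n)
      ≡⟨ ∑-cong representations (vectors n) ⟩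
    ∑[ w ∈ vectors n ] count (λ c → lincomb c B ≈v? w) (vectors m)
      ≡⟨ ∑-swap (vectors n) (vectors m) (λ w c → 𝟙 (lincomb c B ≈v? w)) ⟩
    ∑[ c ∈ vectors m ] count (λ w → lincomb c B ≈v? w) (vectors n)
      ≡⟨ ∑-cong (λ c → ≡.trans (∑-cong (λ w → ≡.cong 𝟙 (≈v?-sym (lincomb c B) w)) (vectors n))
                                (vectors-δ n (lincomb c B))) (vectors m) ⟩
    ∑[ _ ∈ vectors m ] 1
      ≡⟨ vectors-size m ⟩
    q ^ m ∎
    where
    open ≡.≡-Reasoning
    representations : ∀ w → 𝟙 (memb w B) ≡ count (λ c → lincomb c B ≈v? w) (vectors m)
    representations w with memb w B in w∈?
    ... | true with memb-sound w B w∈?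
    ...   | c₀ , c₀-ok = ≡.sym (≡.trans
            (∑-cong (λ c → ≡.cong 𝟙 (≈v?-ext (λ eq → independent-unique indep c c₀ (≋-trans eq (≋-sym c₀-ok)))
                                             (λ eq → ≋-trans (lincomb-cong B eq) c₀-ok))) (vectors m))
            (vectors-δ m c₀))
    representations w | false = ≡.sym (∑-zero (λ c → ≡.cong 𝟙
            (implies-false (λ eq → memb-complete w B (c , ≈v?-sound _ _ eq)) w∈?)) (vectors m))

  ∃-outside-span : ∀ {n m} (B : Vec (Vec Carrier n) m) → Independent B → m < n → ∃ λ v → ¬ v ∈span B
  ∃-outside-span {n} {m} B indep m<n with any (λ v → not (memb v B)) (vectors n) in some-outside
  ... | true with any-witness _ (vectors n) some-outside
  ...   | v , v∉B = v , λ v∈B → case ≡.subst (λ b → not b ≡ true) (memb-complete v B v∈B) v∉B of λ ()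
  ∃-outside-span {n} {m} B indep m<n | false =
    ⊥-elim (ℕ.<⇒≢ (ℕ.^-monoʳ-< q 2≤q m<n) q^m≡q^n)
    where
    open ≡.≡-Reasoning
    q^m≡q^n : q ^ m ≡ q ^ n
    q^m≡q^n = begin
      q ^ m                              ≡⟨ ≡.sym (span-size B indep) ⟩
      count (λ w → memb w B) (vectors n) ≡⟨ ≡.sym (ℕ.+-identityʳ _) ⟩
      count (λ w → memb w B) (vectors n) ℕ.+ 0                ≡⟨ ≡.cong (count (λ w → memb w B) (vectors n) ℕ.+_)
                                                                  (≡.sym (count-false _ (vectors n) some-outside)) ⟩
      count (λ w → memb w B) (vectors n)
        ℕ.+ count (λ w → not (memb w B)) (vectors n)         ≡⟨ count-not (λ w → memb w B) (vectors n) ⟩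
      ∑[ _ ∈ vectors n ] 1 ≡⟨ vectors-size n ⟩
      q ^ n                ∎

  extend-independent : ∀ {n m} j (w : Vec Carrier n) {B : Vec (Vec Carrier n) m} → suc (j ℕ.+ m) ≤ n →
                       Independent (w ∷ B) → ∃ λ (ts : Vec (Vec Carrier n) j) → Independent (w ∷ ts ++ B)
  extend-independent zero    w _     indep = [] , indep
  extend-independent (suc j) w {B} bound indep with extend-independent j w (ℕ.<⇒≤ bound) indep
  ... | ts , indep′ with ∃-outside-span (w ∷ ts ++ B) indep′ bound
  ...   | v , v∉ = v ∷ ts , independent-swap v w (independent-∷ v indep′ v∉)

  -- Hyperplanes of K^(1+m)

  _≋?_ : ∀ {n} (u w : Vec Carrier n) → Dec (u ≋ w)
  _≋?_ = Pointwise.decidable _≟_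

  dot : ∀ {m} → Vec Carrier m → Vec Carrier m → Carrier
  dot []       []       = 0#
  dot (a ∷ as) (b ∷ bs) = a * b + dot as bs

  dot-congˡ : ∀ {m} {a a′ : Vec Carrier m} (b : Vec Carrier m) → a ≋ a′ → dot a b ≈ dot a′ b
  dot-congˡ []       []          = refl
  dot-congˡ (b ∷ bs) (x≈y ∷ a≋a′) = +-cong (*-congʳ x≈y) (dot-congˡ bs a≋a′)

  dot-zeroˡ : ∀ {m} {a : Vec Carrier m} (b : Vec Carrier m) → a ≋ 0v → dot a b ≈ 0#
  dot-zeroˡ []       []          = refl
  dot-zeroˡ (b ∷ bs) (x≈0 ∷ a≋0) =
    trans (+-cong (trans (*-congʳ x≈0) (zeroˡ b)) (dot-zeroˡ bs a≋0)) (+-identityʳ 0#)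

  dot-zeroʳ : ∀ {m} (a : Vec Carrier m) → dot a 0v ≈ 0#
  dot-zeroʳ []       = refl
  dot-zeroʳ (a ∷ as) = trans (+-cong (zeroʳ a) (dot-zeroʳ as)) (+-identityʳ 0#)

  lincomb-zipWith-∷ : ∀ {n m} (c b : Vec Carrier m) (E : Vec (Vec Carrier n) m) →
                      lincomb c (Vec.zipWith _∷_ b E) ≋ dot c b ∷ lincomb c E
  lincomb-zipWith-∷ []      []       []      = ≋-refl
  lincomb-zipWith-∷ (x ∷ c) (b ∷ bs) (e ∷ E) = +v-cong (≋-refl {x = x · (b ∷ e)}) (lincomb-zipWith-∷ c bs E)

  e₀⊕_ : ∀ {m k} → Vec (Vec Carrier m) k → Vec (Vec Carrier (suc m)) (suc k)
  e₀⊕ M = (1# ∷ 0v) ∷ Vec.zipWith _∷_ 0v M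

  lincomb-e₀⊕ : ∀ {m k} c₀ (c : Vec Carrier k) (M : Vec (Vec Carrier m) k) →
                lincomb (c₀ ∷ c) (e₀⊕ M) ≋ c₀ ∷ lincomb c M
  lincomb-e₀⊕ c₀ c M = ≋-trans (+v-cong (≋-refl {x = c₀ · (1# ∷ 0v)}) (lincomb-zipWith-∷ c 0v M))
    (trans (+-cong (*-identityʳ c₀) (dot-zeroʳ c)) (+-identityʳ c₀)
      ∷ ≋-trans (+v-cong (·-zeroʳ c₀) ≋-refl) (+v-identityˡ _))

  e₀⊕-independent : ∀ {m k} (M : Vec (Vec Carrier m) k) → Independent M → Independent (e₀⊕ M)
  e₀⊕-independent M indep (c₀ ∷ c) eq with ≋-trans (≋-sym (lincomb-e₀⊕ c₀ c M)) eq
  ... | c₀≈0 ∷ cM≋0 = c₀≈0 ∷ indep c cM≋0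

  standardBasis : ∀ m → Vec (Vec Carrier m) m
  standardBasis zero    = []
  standardBasis (suc m) = e₀⊕ standardBasis m

  lincomb-standardBasis : ∀ {m} (c : Vec Carrier m) → lincomb c (standardBasis m) ≋ c
  lincomb-standardBasis []      = []
  lincomb-standardBasis (x ∷ c) = ≋-trans (lincomb-e₀⊕ x c _) (refl ∷ lincomb-standardBasis c)

  -- The hyperplane {(y · b , y)} of K^(1+m), the graph of y ↦ y · b;
  -- these are exactly the hyperplanes not containing e₀.
  graphBasis : ∀ {m} → Vec Carrier m → Vec (Vec Carrier (suc m)) m
  graphBasis {m} b = Vec.zipWith _∷_ b (standardBasis m)

  lincomb-graphBasis : ∀ {m} (c b : Vec Carrier m) → lincomb c (graphBasis b) ≋ dot c b ∷ c
  lincomb-graphBasis {m} c b = ≋-trans (lincomb-zipWith-∷ c b (standardBasis m)) (refl ∷ lincomb-standardBasis c)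

  graphBasis-independent : ∀ {m} (b : Vec Carrier m) → Independent (graphBasis b)
  graphBasis-independent b c eq = Pointwise.tail (≋-trans (≋-sym (lincomb-graphBasis c b)) eq)

  Hyperplane : ℕ → Set
  Hyperplane m = Σ (Vec (Vec Carrier (suc m)) m) Independent

  graphs : ∀ m → List (Hyperplane m)
  graphs m = List.map (λ b → graphBasis b , graphBasis-independent b) (vectors m)

  -- Every hyperplane is a graph or contains e₀; the latter are e₀ ⊕ H for a hyperplane H of K^m.
  hyperplanes : ∀ m → List (Hyperplane m)
  hyperplanes zero    = graphs zero
  hyperplanes (suc m) =
    graphs (suc m) List.++ List.map (λ H → e₀⊕ proj₁ H , e₀⊕-independent (proj₁ H) (proj₂ H)) (hyperplanes m)

  memb-graphBasis : ∀ {m} y₀ (y b : Vec Carrier m) → memb (y₀ ∷ y) (graphBasis b) ≡ does (y₀ ≟ dot y b)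
  memb-graphBasis y₀ y b = true⇔true⇒≡
    (λ y∈ → let (c , c-ok) = memb-sound _ (graphBasis b) y∈
                eq = ≋-trans (≋-sym (lincomb-graphBasis c b)) c-ok
            in dec-true (y₀ ≟ dot y b) (trans (sym (Pointwise.head eq)) (dot-congˡ b (Pointwise.tail eq))))
    (λ y₀≈ → memb-complete _ (graphBasis b)
               (y , ≋-trans (lincomb-graphBasis y b) (sym (does-true (y₀ ≟ dot y b) y₀≈) ∷ ≋-refl)))

  memb-e₀⊕ : ∀ {m k} y₀ (y : Vec Carrier m) (M : Vec (Vec Carrier m) k) → memb (y₀ ∷ y) (e₀⊕ M) ≡ memb y M
  memb-e₀⊕ y₀ y M = memb-ext _ _ (e₀⊕ M) M
    (λ { (c₀ ∷ c , c-ok) → c , Pointwise.tail (≋-trans (≋-sym (lincomb-e₀⊕ c₀ c M)) c-ok) })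
    (λ { (c , c-ok) → y₀ ∷ c , ≋-trans (lincomb-e₀⊕ y₀ c M) (refl ∷ c-ok) })

  dot-solutions : ∀ m (y : Vec Carrier (suc m)) → ¬ y ≋ 0v → ∀ t →
                  count (λ b → does (t ≟ dot y b)) (vectors (suc m)) ≡ q ^ m
  dot-solutions m (y₁ ∷ y) y≉0 t with y ≋? 0v
  ... | yes y≋0 = begin
    count (λ b → does (t ≟ dot (y₁ ∷ y) b)) (vectors (suc m))
      ≡⟨ ∑-vectors-suc m _ ⟩
    ∑[ c ∈ Vec.toList enum ] ∑[ b ∈ vectors m ] 𝟙 (does (t ≟ (y₁ * c + dot y b)))
      ≡⟨ ∑-cong (λ c → ∑-cong (λ b → ≡.cong 𝟙 (only-first c b)) (vectors m)) (Vec.toList enum) ⟩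
    ∑[ c ∈ Vec.toList enum ] ∑[ _ ∈ vectors m ] 𝟙 (does (c ≟ (inv y₁≉0 * t)))
      ≡⟨ ∑-cong (λ c → ∑-vectors-const m _) (Vec.toList enum) ⟩
    ∑[ c ∈ Vec.toList enum ] (q ^ m ℕ.* 𝟙 (does (c ≟ (inv y₁≉0 * t))))
      ≡⟨ ∑-*ˡ (q ^ m) (Vec.toList enum) _ ⟩
    q ^ m ℕ.* count (λ c → does (c ≟ (inv y₁≉0 * t))) (Vec.toList enum)
      ≡⟨ ≡.cong (q ^ m ℕ.*_) (enum-δ _) ⟩
    q ^ m ℕ.* 1
      ≡⟨ ℕ.*-identityʳ (q ^ m) ⟩
    q ^ m ∎
    where
    open ≡.≡-Reasoning
    y₁≉0 : ¬ y₁ ≈ 0#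
    y₁≉0 y₁≈0 = y≉0 (y₁≈0 ∷ y≋0)
    dot≈ : ∀ c b → y₁ * c + dot y b ≈ y₁ * c
    dot≈ c b = trans (+-congˡ (dot-zeroˡ b y≋0)) (+-identityʳ _)
    only-first : ∀ c b → does (t ≟ (y₁ * c + dot y b)) ≡ does (c ≟ (inv y₁≉0 * t))
    only-first c b = does-⇔ (mk⇔ (Equivalence.to (solve-*ˡ y₁≉0 t c) ∘ (λ t≈ → trans t≈ (dot≈ c b)))
                                 (λ c≈ → trans (Equivalence.from (solve-*ˡ y₁≉0 t c) c≈) (sym (dot≈ c b))))
                            (t ≟ (y₁ * c + dot y b)) (c ≟ (inv y₁≉0 * t))
  dot-solutions zero    (y₁ ∷ []) y≉0 t | no []≉0 = ⊥-elim ([]≉0 [])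
  dot-solutions (suc m) (y₁ ∷ y)  y≉0 t | no y≉0′ = begin
    count (λ b → does (t ≟ dot (y₁ ∷ y) b)) (vectors (suc (suc m)))
      ≡⟨ ∑-vectors-suc (suc m) _ ⟩
    ∑[ c ∈ Vec.toList enum ] ∑[ b ∈ vectors (suc m) ] 𝟙 (does (t ≟ (y₁ * c + dot y b)))
      ≡⟨ ∑-cong (λ c → ∑-cong (λ b → ≡.cong 𝟙 (shift c b)) (vectors (suc m))) (Vec.toList enum) ⟩
    ∑[ c ∈ Vec.toList enum ] count (λ b → does ((t - y₁ * c) ≟ dot y b)) (vectors (suc m))
      ≡⟨ ∑-cong (λ c → dot-solutions m y y≉0′ (t - y₁ * c)) (Vec.toList enum) ⟩
    ∑[ _ ∈ Vec.toList enum ] q ^ m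
      ≡⟨ ∑-enum-const (q ^ m) ⟩
    q ^ suc m ∎
    where
    open ≡.≡-Reasoning
    shift : ∀ c b → does (t ≟ (y₁ * c + dot y b)) ≡ does ((t - y₁ * c) ≟ dot y b)
    shift c b = does-⇔ (solve-+ˡ t (y₁ * c) (dot y b)) (t ≟ (y₁ * c + dot y b)) ((t - y₁ * c) ≟ dot y b)

  graphs-through-axis : ∀ m y₀ (y : Vec Carrier m) → ¬ y₀ ≈ 0# → y ≋ 0v →
                        count (λ H → memb (y₀ ∷ y) (proj₁ H)) (graphs m) ≡ 0
  graphs-through-axis m y₀ y y₀≉0 y≋0 = ≡.trans (∑-map _ (vectors m) _) (∑-zero misses (vectors m))
    where
    misses : ∀ b → 𝟙 (memb (y₀ ∷ y) (graphBasis b)) ≡ 0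
    misses b = ≡.cong 𝟙 (≡.trans (memb-graphBasis y₀ y b)
                 (dec-false (y₀ ≟ dot y b) (λ y₀≈ → y₀≉0 (trans y₀≈ (dot-zeroˡ b y≋0)))))

  graphs-through : ∀ m y₀ (y : Vec Carrier (suc m)) → ¬ y ≋ 0v →
                   count (λ H → memb (y₀ ∷ y) (proj₁ H)) (graphs (suc m)) ≡ q ^ m
  graphs-through m y₀ y y≉0 = ≡.trans (∑-map _ (vectors (suc m)) _)
    (≡.trans (∑-cong (λ b → ≡.cong 𝟙 (memb-graphBasis y₀ y b)) (vectors (suc m))) (dot-solutions m y y≉0 y₀))

  hyperplanes-size : ∀ m → ∑[ _ ∈ hyperplanes m ] 1 ≡ gauss q (suc m)
  hyperplanes-size zero    = ≡.cong suc (≡.sym (ℕ.*-zeroʳ q))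
  hyperplanes-size (suc m) = begin
    ∑[ _ ∈ hyperplanes (suc m) ] 1
      ≡⟨ ∑-++ (graphs (suc m)) _ _ ⟩
    (∑[ _ ∈ graphs (suc m) ] 1) ℕ.+ (∑[ _ ∈ List.map _ (hyperplanes m) ] 1)
      ≡⟨ ≡.cong₂ ℕ._+_ (≡.trans (∑-map _ (vectors (suc m)) _) (vectors-size (suc m)))
                       (≡.trans (∑-map _ (hyperplanes m) _) (hyperplanes-size m)) ⟩
    q ^ suc m ℕ.+ gauss q (suc m)
      ≡⟨ ≡.sym (gauss-suc q (suc m)) ⟩
    gauss q (suc (suc m)) ∎
    where open ≡.≡-Reasoning

  hyperplanes-suc-through : ∀ m y₀ (y : Vec Carrier (suc m)) →
    count (λ H → memb (y₀ ∷ y) (proj₁ H)) (hyperplanes (suc m))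
      ≡ count (λ H → memb (y₀ ∷ y) (proj₁ H)) (graphs (suc m)) ℕ.+ count (λ H → memb y (proj₁ H)) (hyperplanes m)
  hyperplanes-suc-through m y₀ y = ≡.trans (∑-++ (graphs (suc m)) _ _)
    (≡.cong (count (λ H → memb (y₀ ∷ y) (proj₁ H)) (graphs (suc m)) ℕ.+_) (≡.trans (∑-map _ (hyperplanes m) _)
                              (∑-cong (λ H → ≡.cong 𝟙 (memb-e₀⊕ y₀ y (proj₁ H))) (hyperplanes m))))

  hyperplanes-through : ∀ m (y : Vec Carrier (suc m)) → ¬ y ≋ 0v →
                        count (λ H → memb y (proj₁ H)) (hyperplanes m) ≡ gauss q m
  hyperplanes-through zero    (y₀ ∷ []) y≉0 = graphs-through-axis zero y₀ [] (λ y₀≈0 → y≉0 (y₀≈0 ∷ [])) []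
  hyperplanes-through (suc m) (y₀ ∷ y)  y≉0 with y ≋? 0v
  ... | yes y≋0 = begin
    count (λ H → memb (y₀ ∷ y) (proj₁ H)) (hyperplanes (suc m))
      ≡⟨ hyperplanes-suc-through m y₀ y ⟩
    count (λ H → memb (y₀ ∷ y) (proj₁ H)) (graphs (suc m)) ℕ.+ count (λ H → memb y (proj₁ H)) (hyperplanes m)
      ≡⟨ ≡.cong₂ ℕ._+_ (graphs-through-axis (suc m) y₀ y (λ y₀≈0 → y≉0 (y₀≈0 ∷ y≋0)) y≋0)
                       (∑-cong (λ H → ≡.cong 𝟙 (memb-complete y (proj₁ H) (0v , ≋-trans (lincomb-0v (proj₁ H)) (≋-sym y≋0))))
                               (hyperplanes m)) ⟩
    ∑[ _ ∈ hyperplanes m ] 1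
      ≡⟨ hyperplanes-size m ⟩
    gauss q (suc m) ∎
    where open ≡.≡-Reasoning
  ... | no y≉0′ = begin
    count (λ H → memb (y₀ ∷ y) (proj₁ H)) (hyperplanes (suc m))
      ≡⟨ hyperplanes-suc-through m y₀ y ⟩
    count (λ H → memb (y₀ ∷ y) (proj₁ H)) (graphs (suc m)) ℕ.+ count (λ H → memb y (proj₁ H)) (hyperplanes m)
      ≡⟨ ≡.cong₂ ℕ._+_ (graphs-through m y₀ y y≉0′) (hyperplanes-through m y y≉0′) ⟩
    q ^ m ℕ.+ gauss q m
      ≡⟨ ≡.sym (gauss-suc q m) ⟩
    gauss q (suc m) ∎
    where open ≡.≡-Reasoning

  -- Lines

  module _ {n : ℕ} where

    ∈span-line⁻ : ∀ {x w : Vec Carrier n} → x ∈span (w ∷ []) → ∃ λ c → c · w ≋ x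
    ∈span-line⁻ (c ∷ [] , c-ok) = c , ≋-trans (≋-sym (+v-identityʳ _)) c-ok

    ∈span-line : ∀ {x w : Vec Carrier n} c → c · w ≋ x → x ∈span (w ∷ [])
    ∈span-line c cw≋x = c ∷ [] , ≋-trans (+v-identityʳ _) cw≋x

    ∈span-resp : ∀ {m} (B : Vec (Vec Carrier n) m) {u u′} → u ≋ u′ → u ∈span B → u′ ∈span B
    ∈span-resp B u≋u′ (c , c-ok) = c , ≋-trans c-ok u≋u′

    ∈span-scale : ∀ {m} (B : Vec (Vec Carrier n) m) s {u} → u ∈span B → s · u ∈span B
    ∈span-scale B s (c , c-ok) = s · c , ≋-trans (lincomb-· s c B) (·-cong refl c-ok)

    line-coefficient≉0 : ∀ {x w : Vec Carrier n} c → c · w ≋ x → ¬ x ≋ 0v → ¬ c ≈ 0#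
    line-coefficient≉0 {w = w} c cw≋x x≉0 c≈0 = x≉0 (≋-trans (≋-sym cw≋x) (≋-trans (·-cong c≈0 ≋-refl) (·-zeroˡ w)))

    line-sym : ∀ {x w : Vec Carrier n} → ¬ x ≋ 0v → x ∈span (w ∷ []) → w ∈span (x ∷ [])
    line-sym {x} {w} x≉0 x∈w with ∈span-line⁻ x∈w
    ... | c , cw≋x = ∈span-line _ (≋-trans (·-cong refl (≋-sym cw≋x)) (·-inverseˡ (line-coefficient≉0 c cw≋x x≉0) w))

    line-nonzero : ∀ {x w : Vec Carrier n} → ¬ x ≋ 0v → x ∈span (w ∷ []) → ¬ w ≋ 0v
    line-nonzero {x} {w} x≉0 x∈w w≋0 with ∈span-line⁻ x∈w
    ... | c , cw≋x = x≉0 (≋-trans (≋-sym cw≋x) (≋-trans (·-cong refl w≋0) (·-zeroʳ c)))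

    memb-sameLine : ∀ {m} (B : Vec (Vec Carrier n) m) {x w : Vec Carrier n} →
                    ¬ x ≋ 0v → x ∈span (w ∷ []) → memb x B ≡ memb w B
    memb-sameLine B {x} {w} x≉0 x∈w with ∈span-line⁻ x∈w | ∈span-line⁻ (line-sym x≉0 x∈w)
    ... | c , cw≋x | d , dx≋w = memb-ext x w B B
      (λ x∈B → ∈span-resp B dx≋w (∈span-scale B d x∈B))
      (λ w∈B → ∈span-resp B cw≋x (∈span-scale B c w∈B))

    line-generators : ∀ {x : Vec Carrier n} → ¬ x ≋ 0v → count (λ w → memb x (w ∷ [])) (vectors n) ≡ suc (q ∸ 2)
    line-generators {x} x≉0 = ℕ.suc-injective (begin
      suc (count (λ w → memb x (w ∷ [])) (vectors n))
        ≡⟨ ℕ.+-comm 1 _ ⟩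
      count (λ w → memb x (w ∷ [])) (vectors n) ℕ.+ 1
        ≡⟨ ≡.cong (count (λ w → memb x (w ∷ [])) (vectors n) ℕ.+_) (≡.sym (vectors-δ n 0v)) ⟩
      count (λ w → memb x (w ∷ [])) (vectors n) ℕ.+ count (_≈v? 0v) (vectors n)
        ≡⟨ ≡.sym (∑-+ (vectors n) _ _) ⟩
      ∑[ w ∈ vectors n ] (𝟙 (memb x (w ∷ [])) ℕ.+ 𝟙 (w ≈v? 0v))
        ≡⟨ ∑-cong nonzero-or-zero (vectors n) ⟩
      count (λ w → memb w (x ∷ [])) (vectors n)
        ≡⟨ span-size (x ∷ []) x-independent ⟩
      q ℕ.* 1
        ≡⟨ ℕ.*-identityʳ q ⟩
      q
        ≡⟨ ≡.sym (ℕ.m+[n∸m]≡n 2≤q) ⟩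
      suc (suc (q ∸ 2)) ∎)
      where
      open ≡.≡-Reasoning
      x-independent : Independent (x ∷ [])
      x-independent = independent-∷ x (λ { [] _ → [] }) (λ { ([] , 0≋x) → x≉0 (≋-sym 0≋x) })
      nonzero-or-zero : ∀ w → 𝟙 (memb x (w ∷ [])) ℕ.+ 𝟙 (w ≈v? 0v) ≡ 𝟙 (memb w (x ∷ []))
      nonzero-or-zero w with w ≋? 0v
      ... | yes w≋0 = ≡.trans
        (≡.cong₂ (λ a b → 𝟙 a ℕ.+ 𝟙 b) (¬-not (λ x∈w → line-nonzero x≉0 (memb-sound x (w ∷ []) x∈w) w≋0))
                                       (≈v?-complete w 0v w≋0))
        (≡.cong 𝟙 (≡.sym (memb-complete w (x ∷ []) (∈span-line 0# (≋-trans (·-zeroˡ x) (≋-sym w≋0))))))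
      ... | no w≉0 = ≡.trans
        (≡.cong₂ (λ a b → 𝟙 a ℕ.+ 𝟙 b) (memb-ext x w (w ∷ []) (x ∷ []) (line-sym x≉0) (line-sym w≉0))
                                       (¬-not (λ w≈0 → w≉0 (≈v?-sound w 0v w≈0))))
        (ℕ.+-identityʳ _)

module _ (K : FiniteField) where
  open FiniteField K using (Carrier; q; 1#; setoid) renaming (refl to ≈-refl)
  open LinearAlgebra K
  open VecEquality setoid using (≋-refl; ≋-sym; ≋-trans)
  open import Data.Rational using (_+_; _*_; -_; _-_)
  open ≡ using (refl; sym; trans; cong; cong₂; module ≡-Reasoning)

  -- Spans of functions on nonzero vectors

  module _ {n : ℕ} where
    open LinAlg K n using (LVec; lincombL; InSpan)

    private variable
      I J : Set

    lincombL-++ : ∀ (g : I → LVec) xs ys x →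
                  lincombL g (xs List.++ ys) x ≡ lincombL g xs x + lincombL g ys x
    lincombL-++ g []             ys x = sym (ℚ.+-identityˡ _)
    lincombL-++ g ((c , i) ∷ xs) ys x =
      trans (cong (c * g i x +_) (lincombL-++ g xs ys x)) (sym (ℚ.+-assoc (c * g i x) _ _))

    lincombL-concatMap : ∀ {A : Set} (g : I → LVec) (h : A → List (ℚ × I)) as x →
                         lincombL g (List.concatMap h as) x ≡ ∑ℚ as (λ a → lincombL g (h a) x)
    lincombL-concatMap g h []       x = refl
    lincombL-concatMap g h (a ∷ as) x =
      trans (lincombL-++ g (h a) (List.concatMap h as) x) (cong (lincombL g (h a) x +_) (lincombL-concatMap g h as x))

    lincombL-scale : ∀ (g : I → LVec) s cs x → lincombL g (scaleL s cs) x ≡ s * lincombL g cs x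
    lincombL-scale g s []             x = sym (ℚ.*-zeroʳ s)
    lincombL-scale g s ((c , i) ∷ cs) x =
      trans (cong₂ _+_ (ℚ.*-assoc s c (g i x)) (lincombL-scale g s cs x)) (sym (ℚ.*-distribˡ-+ s _ _))

    lincombL-reindex : ∀ (g : J → LVec) (f : I → J) cs x → lincombL g (reindex f cs) x ≡ lincombL (g ∘ f) cs x
    lincombL-reindex g f []             x = refl
    lincombL-reindex g f ((c , i) ∷ cs) x = cong (c * g (f i) x +_) (lincombL-reindex g f cs x)

    lincombL-const : ∀ (g : I → LVec) c is x → lincombL g (List.map (c ,_) is) x ≡ ∑ℚ is (λ i → c * g i x)
    lincombL-const g c []       x = refl
    lincombL-const g c (i ∷ is) x = cong (c * g i x +_) (lincombL-const g c is x)

    InSpan-gen : ∀ (g : I → LVec) i → InSpan g (g i)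
    InSpan-gen g i = (1ℚ , i) ∷ [] , λ x _ → sym (trans (ℚ.+-identityʳ _) (ℚ.*-identityˡ _))

    InSpan-trans : ∀ (g : I → LVec) (h : J → LVec) → (∀ i → InSpan h (g i)) → ∀ v → InSpan g v → InSpan h v
    InSpan-trans {I} {J} g h g⊆h v (cs , v≡) = expand cs , λ x x≢0 → trans (v≡ x x≢0) (expand-ok cs x x≢0)
      where
      expand : List (ℚ × I) → List (ℚ × J)
      expand []             = []
      expand ((c , i) ∷ cs) = scaleL c (proj₁ (g⊆h i)) List.++ expand cs
      expand-ok : ∀ cs x → LinAlg.NonZero K n x → lincombL g cs x ≡ lincombL h (expand cs) x
      expand-ok []             x x≢0 = refl
      expand-ok ((c , i) ∷ cs) x x≢0 = sym (begin
        lincombL h (scaleL c (proj₁ (g⊆h i)) List.++ expand cs) x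
          ≡⟨ lincombL-++ h (scaleL c (proj₁ (g⊆h i))) (expand cs) x ⟩
        lincombL h (scaleL c (proj₁ (g⊆h i))) x + lincombL h (expand cs) x
          ≡⟨ cong₂ _+_ (lincombL-scale h c (proj₁ (g⊆h i)) x) (sym (expand-ok cs x x≢0)) ⟩
        c * lincombL h (proj₁ (g⊆h i)) x + lincombL g cs x
          ≡⟨ cong (λ v → c * v + lincombL g cs x) (sym (proj₂ (g⊆h i) x x≢0)) ⟩
        c * g i x + lincombL g cs x ∎)
        where open ≡-Reasoning

  module LinesOutside {n k} (BF : Vec (Vec Carrier n) k) where
    open LinAlg K n using (LVec; NonZero; Disjoint; lincombL; InSpan; eL; one; oneF; EIdx; eIdx; oneFIdx; EGen)

    outside-nonzero : ∀ w → memb w BF ≡ false → NonZero w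
    outside-nonzero w w∉F w≈0 =
      case trans (sym w∉F) (memb-complete w BF (0v , ≋-trans (lincomb-0v BF) (≋-sym (≈v⇒≋ w≈0)))) of λ ()

    outside-disjoint : ∀ w → memb w BF ≡ false → Disjoint (w ∷ []) BF
    outside-disjoint w w∉F x (c , x∈w) (d , x∈F) with x ≋? 0v
    ... | yes x≋0 = Pointwise.lookup x≋0
    ... | no x≉0  = case trans (sym w∉F) (trans (sym (memb-sameLine BF x≉0 (c , ≈v⇒≋ x∈w)))
                                                     (memb-complete x BF (d , ≈v⇒≋ x∈F))) of λ ()

    Line : Set
    Line = Σ (Vec Carrier n) λ w → NonZero w × Disjoint (w ∷ []) BF

    lineGen : Line → LVec
    lineGen (w , _) = eL w

    toEIdx : Line → EIdx BF
    toEIdx (w , w≢0 , w∩F) = eIdx w w≢0 w∩F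

    lineTerm : ∀ w → ℚ → (b : Bool) → memb w BF ≡ b → List (ℚ × Line)
    lineTerm w c true  _   = []
    lineTerm w c false w∉F = (c , w , outside-nonzero w w∉F , outside-disjoint w w∉F) ∷ []

    lineTerm-value : ∀ w c b (w∈?F : memb w BF ≡ b) x →
                     lincombL lineGen (lineTerm w c b w∈?F) x ≡ c * 𝟙ℚ (not b ∧ memb x (w ∷ []))
    lineTerm-value w c true  _ x = sym (ℚ.*-zeroʳ c)
    lineTerm-value w c false _ x = ℚ.+-identityʳ _

    -- Each line through x is hit by q - 1 nonzero vectors w, hence the weight γ = 1/(q - 1).
    γ : ℚ
    γ = 1/suc (q ∸ 2)

    outsideLines : LVec → List (ℚ × Line)
    outsideLines g = List.concatMap (λ w → lineTerm w (γ * g w) (memb w BF) refl) (vectors n)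

    LineConstant : LVec → Set
    LineConstant g = ∀ x w → ¬ x ≋ 0v → x ∈span (w ∷ []) → g w ≡ g x

    memb-lineConstant : ∀ (f : Bool → ℚ) {m} (B : Vec (Vec Carrier n) m) → LineConstant (λ x → f (memb x B))
    memb-lineConstant f B x w x≉0 x∈w = cong f (sym (memb-sameLine B x≉0 x∈w))

    outsideLine-through : ∀ {x} → ¬ x ≋ 0v → ∀ w →
                          not (memb w BF) ∧ memb x (w ∷ []) ≡ not (memb x BF) ∧ memb x (w ∷ [])
    outsideLine-through {x} x≉0 w with memb x (w ∷ []) in x∈w
    ... | true  = cong (λ b → not b ∧ true) (sym (memb-sameLine BF x≉0 (memb-sound x (w ∷ []) x∈w)))
    ... | false = trans (∧-zeroʳ _) (sym (∧-zeroʳ _))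

    weighted-line-generators : ∀ {x} → ¬ x ≋ 0v → ∀ a b →
      (γ * a) * toℚ (count (λ w → not b ∧ memb x (w ∷ [])) (vectors n)) ≡ a * 𝟙ℚ (not b)
    weighted-line-generators x≉0 a true = begin
      (γ * a) * toℚ (count (λ _ → false) (vectors n)) ≡⟨ cong (λ c → (γ * a) * toℚ c) (∑-zero (λ _ → refl) (vectors n)) ⟩
      (γ * a) * toℚ 0                                 ≡⟨ cong ((γ * a) *_) toℚ-0 ⟩
      (γ * a) * 0ℚ                                    ≡⟨ ℚ.*-zeroʳ (γ * a) ⟩
      0ℚ                                              ≡⟨ sym (ℚ.*-zeroʳ a) ⟩
      a * 0ℚ                                          ∎
      where open ≡-Reasoning
    weighted-line-generators x≉0 a false = begin
      (γ * a) * toℚ (count (λ w → memb _ (w ∷ [])) (vectors n)) ≡⟨ cong (λ c → (γ * a) * toℚ c) (line-generators x≉0) ⟩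
      (γ * a) * toℚ (suc (q ∸ 2))                               ≡⟨ cong (_* toℚ (suc (q ∸ 2))) (ℚ.*-comm γ a) ⟩
      (a * γ) * toℚ (suc (q ∸ 2))                               ≡⟨ ℚ.*-assoc a γ _ ⟩
      a * (γ * toℚ (suc (q ∸ 2)))                               ≡⟨ cong (a *_) (1/suc-inverse (q ∸ 2)) ⟩
      a * 1ℚ                                                    ∎
      where open ≡-Reasoning

    outsideLines-value : ∀ g → LineConstant g → ∀ x → ¬ x ≋ 0v →
                         lincombL lineGen (outsideLines g) x ≡ g x * 𝟙ℚ (not (memb x BF))
    outsideLines-value g g-const x x≉0 = begin
      lincombL lineGen (outsideLines g) x
        ≡⟨ lincombL-concatMap lineGen _ (vectors n) x ⟩
      ∑ℚ (vectors n) (λ w → lincombL lineGen (lineTerm w (γ * g w) (memb w BF) refl) x)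
        ≡⟨ ∑ℚ-cong (λ w → trans (lineTerm-value w _ _ refl x) (term w)) (vectors n) ⟩
      ∑ℚ (vectors n) (λ w → (γ * g x) * 𝟙ℚ (not (memb x BF) ∧ memb x (w ∷ [])))
        ≡⟨ ∑ℚ-count (γ * g x) _ (vectors n) ⟩
      (γ * g x) * toℚ (count (λ w → not (memb x BF) ∧ memb x (w ∷ [])) (vectors n))
        ≡⟨ weighted-line-generators x≉0 (g x) (memb x BF) ⟩
      g x * 𝟙ℚ (not (memb x BF)) ∎
      where
      open ≡-Reasoning
      term : ∀ w → (γ * g w) * 𝟙ℚ (not (memb w BF) ∧ memb x (w ∷ []))
                 ≡ (γ * g x) * 𝟙ℚ (not (memb x BF) ∧ memb x (w ∷ []))
      term w = trans (cong (λ b → (γ * g w) * 𝟙ℚ b) (outsideLine-through x≉0 w))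
                       (by-line (memb x (w ∷ [])) refl)
        where
        by-line : ∀ b → memb x (w ∷ []) ≡ b →
                  (γ * g w) * 𝟙ℚ (not (memb x BF) ∧ b) ≡ (γ * g x) * 𝟙ℚ (not (memb x BF) ∧ b)
        by-line true  x∈w = cong (λ v → (γ * v) * 𝟙ℚ (not (memb x BF) ∧ true))
                                   (g-const x w x≉0 (memb-sound x (w ∷ []) x∈w))
        by-line false _   = begin
          (γ * g w) * 𝟙ℚ (not (memb x BF) ∧ false) ≡⟨ cong (λ b → (γ * g w) * 𝟙ℚ b) (∧-zeroʳ _) ⟩
          (γ * g w) * 0ℚ                           ≡⟨ ℚ.*-zeroʳ (γ * g w) ⟩
          0ℚ                                       ≡⟨ sym (ℚ.*-zeroʳ (γ * g x)) ⟩
          (γ * g x) * 0ℚ                           ≡⟨ cong (λ b → (γ * g x) * 𝟙ℚ b) (sym (∧-zeroʳ _)) ⟩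
          (γ * g x) * 𝟙ℚ (not (memb x BF) ∧ false) ∎

    NonZero⇒≉0v : ∀ {x} → NonZero x → ¬ x ≋ 0v
    NonZero⇒≉0v x≢0 x≋0 = x≢0 (Pointwise.lookup x≋0)

    InSpan-E : ∀ g a → LineConstant g → (∀ x → ¬ x ≋ 0v → memb x BF ≡ true → g x ≡ a) → InSpan (EGen BF) g
    InSpan-E g a g-const g-on-F = (a , oneFIdx) ∷ reindex toEIdx (outsideLines g) , value
      where
      inside-or-outside : ∀ x → ¬ x ≋ 0v → ∀ b → memb x BF ≡ b → a * 𝟙ℚ b + g x * 𝟙ℚ (not b) ≡ g x
      inside-or-outside x x≉0 true x∈F = begin
        a * 1ℚ + g x * 0ℚ ≡⟨ cong₂ _+_ (ℚ.*-identityʳ a) (ℚ.*-zeroʳ (g x)) ⟩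
        a + 0ℚ            ≡⟨ ℚ.+-identityʳ a ⟩
        a                 ≡⟨ sym (g-on-F x x≉0 x∈F) ⟩
        g x               ∎
        where open ≡-Reasoning
      inside-or-outside x x≉0 false _ = begin
        a * 0ℚ + g x * 1ℚ ≡⟨ cong₂ _+_ (ℚ.*-zeroʳ a) (ℚ.*-identityʳ (g x)) ⟩
        0ℚ + g x          ≡⟨ ℚ.+-identityˡ (g x) ⟩
        g x               ∎
        where open ≡-Reasoning
      value : ∀ x → NonZero x → g x ≡ a * oneF BF x + lincombL (EGen BF) (reindex toEIdx (outsideLines g)) x
      value x x≢0 = sym (trans
        (cong (a * oneF BF x +_) (trans (lincombL-reindex (EGen BF) toEIdx (outsideLines g) x)
                                                (outsideLines-value g g-const x (NonZero⇒≉0v x≢0))))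
        (inside-or-outside x (NonZero⇒≉0v x≢0) (memb x BF) refl))

    oneOrLine : ⊤ ⊎ Line → LVec
    oneOrLine = [ (λ _ → one) , lineGen ]

    oneF-InSpan : InSpan oneOrLine (oneF BF)
    oneF-InSpan = (1ℚ , inj₁ tt) ∷ reindex inj₂ (scaleL (- 1ℚ) (outsideLines one)) , value
      where
      complement : ∀ b → 𝟙ℚ b ≡ 1ℚ * 1ℚ + (- 1ℚ) * (1ℚ * 𝟙ℚ (not b))
      complement true  = refl
      complement false = refl
      value : ∀ x → NonZero x → oneF BF x ≡ 1ℚ * 1ℚ + lincombL oneOrLine (reindex inj₂ (scaleL (- 1ℚ) (outsideLines one))) x
      value x x≢0 = trans (complement (memb x BF)) (cong (1ℚ * 1ℚ +_) (sym (begin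
        lincombL oneOrLine (reindex inj₂ (scaleL (- 1ℚ) (outsideLines one))) x
          ≡⟨ lincombL-reindex oneOrLine inj₂ (scaleL (- 1ℚ) (outsideLines one)) x ⟩
        lincombL lineGen (scaleL (- 1ℚ) (outsideLines one)) x
          ≡⟨ lincombL-scale lineGen (- 1ℚ) (outsideLines one) x ⟩
        (- 1ℚ) * lincombL lineGen (outsideLines one) x
          ≡⟨ cong ((- 1ℚ) *_) (outsideLines-value one (λ _ _ _ _ → refl) x (NonZero⇒≉0v x≢0)) ⟩
        (- 1ℚ) * (1ℚ * 𝟙ℚ (not (memb x BF))) ∎)))
        where open ≡-Reasoning

  module _ {n′ k} (r : ℕ) (BF : Vec (Vec Carrier (suc n′)) k) where
    open LinAlg K (suc n′) using (InSpan; PGen; pIdx; oneIdx; Disjoint)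

    -- 1_S = β ([r]·𝟏 - p_S) with β = 1/[n]
    indicator-InSpan-P : ∀ (S : Vec (Vec Carrier (suc n′)) r) → Independent S → Disjoint S BF →
                         InSpan (PGen r BF) (λ x → 𝟙ℚ (memb x S))
    indicator-InSpan-P S S-indep S∩F =
      (β * R , oneIdx) ∷ (- β , pIdx S (Independent⇒LinIndep S S-indep) S∩F) ∷ [] ,
      λ x _ → indicator-from-p β R N βN≡1 (memb x S)
      where
      β = 1/suc (q ℕ.* gauss q n′)
      R = ℤ.+ gauss q r ℚ./ 1
      N = ℤ.+ gauss q (suc n′) ℚ./ 1
      βN≡1 : β * N ≡ 1ℚ
      βN≡1 = trans (cong (β *_) (sym (toℚ-def (gauss q (suc n′))))) (1/suc-inverse _)

  -- Coordinates with respect to w ∷ ts identify U with K^(1+r) and w with e₀.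
  module LineIndicator {n k r′} (BF : Vec (Vec Carrier n) k) (w : Vec Carrier n)
                       (ts : Vec (Vec Carrier n) (suc r′)) (indep : Independent (w ∷ ts ++ BF)) where
    open LinAlg K n using (LVec; lincombL; eL; Disjoint)

    us : Vec (Vec Carrier n) (suc (suc r′))
    us = w ∷ ts

    us-independent : Independent us
    us-independent = independent-++ˡ us BF indep

    ℋ 𝒢 : List (Hyperplane (suc r′))
    ℋ = hyperplanes (suc r′)
    𝒢 = graphs (suc r′)

    hyperplaneIndicator : Hyperplane (suc r′) → LVec
    hyperplaneIndicator H x = 𝟙ℚ (memb x (image us (proj₁ H)))

    image-independent : ∀ (H : Hyperplane (suc r′)) → Independent (image us (proj₁ H))
    image-independent H = independent-image us-independent (proj₂ H)

    image-disjoint : ∀ (H : Hyperplane (suc r′)) → Disjoint (image us (proj₁ H)) BF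
    image-disjoint H x (c , x∈H) (d , x∈F) = Pointwise.lookup
      (independent-++-disjoint us BF indep {x} (∈span-image us (proj₁ H) (c , ≈v⇒≋ x∈H)) (d , ≈v⇒≋ x∈F))

    #through : List (Hyperplane (suc r′)) → Vec Carrier n → ℕ
    #through L x = count (λ H → memb x (image us (proj₁ H))) L

    #through-coordinates : ∀ L {x} y → lincomb y us ≋ x → #through L x ≡ count (λ H → memb y (proj₁ H)) L
    #through-coordinates L y y-ok = ∑-cong (λ H → cong 𝟙 (memb-image (proj₁ H) us-independent y y-ok)) L

    #through-outside : ∀ L {x} → memb x us ≡ false → #through L x ≡ 0
    #through-outside L x∉U = ∑-zero (λ H → cong 𝟙 (memb-image-outside us (proj₁ H) x∉U)) L

    memb-w-coordinates : ∀ {x} y₀ y → lincomb (y₀ ∷ y) us ≋ x → memb x (w ∷ []) ≡ does (y ≋? 0v)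
    memb-w-coordinates {x} y₀ y y-ok = true⇔true⇒≡
      (λ x∈w → let (c , cw≋x) = ∈span-line⁻ (memb-sound x (w ∷ []) x∈w)
               in dec-true (y ≋? 0v) (≋-sym (Pointwise.tail (independent-unique us-independent (c ∷ 0v) (y₀ ∷ y)
                    (≋-trans (on-line c) (≋-trans cw≋x (≋-sym y-ok)))))))
      (λ y≋0? → memb-complete x (w ∷ []) (∈span-line y₀ (≋-trans (≋-sym (on-line y₀))
                  (≋-trans (lincomb-cong us (≈-refl ∷ ≋-sym (does-true (y ≋? 0v) y≋0?))) y-ok))))
      where
      on-line : ∀ c → lincomb (c ∷ 0v) us ≋ c · w
      on-line c = ≋-trans (+v-cong ≋-refl (lincomb-0v ts)) (+v-identityʳ (c · w))

    memb-w-outside : ∀ {x} → memb x us ≡ false → memb x (w ∷ []) ≡ false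
    memb-w-outside {x} = implies-false λ x∈w →
      let (c , cw≋x) = ∈span-line⁻ (memb-sound x (w ∷ []) x∈w)
      in memb-complete x us (c ∷ 0v , ≋-trans (+v-cong ≋-refl (lincomb-0v ts))
                                               (≋-trans (+v-identityʳ (c · w)) cw≋x))

    -- With r = 1 + r′: Σ_H 1_H = [r]·1_U and Σ_{H graph} 1_H = q^(r-1)·(1_U - e_w), whence these coefficients.
    c₁ c₂ : ℚ
    c₁ = 1/suc (q ℕ.* gauss q r′)
    c₂ = - 1/suc (ℕ.pred (q ^ r′))

    coefficients : List (ℚ × Hyperplane (suc r′))
    coefficients = List.map (c₁ ,_) (ℋ) List.++ List.map (c₂ ,_) (𝒢)

    coefficients-value : ∀ x → lincombL hyperplaneIndicator coefficients x
                               ≡ c₁ * toℚ (#through (ℋ) x) + c₂ * toℚ (#through (𝒢) x)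
    coefficients-value x = trans (lincombL-++ hyperplaneIndicator (List.map (c₁ ,_) ℋ) _ x)
      (cong₂ _+_ (trans (lincombL-const hyperplaneIndicator c₁ ℋ x) (∑ℚ-count c₁ _ ℋ))
                 (trans (lincombL-const hyperplaneIndicator c₂ 𝒢 x) (∑ℚ-count c₂ _ 𝒢)))

    c₁[r]≡1 : c₁ * toℚ (gauss q (suc r′)) ≡ 1ℚ
    c₁[r]≡1 = 1/suc-inverse (q ℕ.* gauss q r′)

    c₂q^r′≡-1 : c₂ * toℚ (q ^ r′) ≡ - 1ℚ
    c₂q^r′≡-1 = begin
      c₂ * toℚ (q ^ r′)         ≡⟨ cong (λ m → c₂ * toℚ m) (sym (suc-pred-q^ r′)) ⟩
      - 1/suc p * toℚ (suc p)   ≡⟨ sym (ℚ.neg-distribˡ-* (1/suc p) (toℚ (suc p))) ⟩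
      - (1/suc p * toℚ (suc p)) ≡⟨ cong -_ (1/suc-inverse p) ⟩
      - 1ℚ                      ∎
      where
      open ≡-Reasoning
      p = ℕ.pred (q ^ r′)

    c·0≡0 : ∀ c → c * toℚ 0 ≡ 0ℚ
    c·0≡0 c = trans (cong (c *_) toℚ-0) (ℚ.*-zeroʳ c)

    combination-in-U : ∀ {y₀} {y : Vec Carrier (suc r′)} → ¬ (y₀ ∷ y) ≋ 0v →
                  c₁ * toℚ (gauss q (suc r′)) + c₂ * toℚ (count (λ H → memb (y₀ ∷ y) (proj₁ H)) (𝒢))
                    ≡ 𝟙ℚ (does (y ≋? 0v))
    combination-in-U {y₀} {y} y≉0 with y ≋? 0v
    ... | yes y≋0 = begin
      c₁ * toℚ (gauss q (suc r′)) + c₂ * toℚ (count (λ H → memb (y₀ ∷ y) (proj₁ H)) (𝒢))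
        ≡⟨ cong (λ a → c₁ * toℚ (gauss q (suc r′)) + c₂ * toℚ a)
                  (graphs-through-axis (suc r′) y₀ y (λ y₀≈0 → y≉0 (y₀≈0 ∷ y≋0)) y≋0) ⟩
      c₁ * toℚ (gauss q (suc r′)) + c₂ * toℚ 0
        ≡⟨ cong₂ _+_ c₁[r]≡1 (c·0≡0 c₂) ⟩
      1ℚ + 0ℚ
        ≡⟨ ℚ.+-identityʳ 1ℚ ⟩
      1ℚ ∎
      where open ≡-Reasoning
    ... | no y≉0′ = begin
      c₁ * toℚ (gauss q (suc r′)) + c₂ * toℚ (count (λ H → memb (y₀ ∷ y) (proj₁ H)) (𝒢))
        ≡⟨ cong (λ a → c₁ * toℚ (gauss q (suc r′)) + c₂ * toℚ a) (graphs-through r′ y₀ y y≉0′) ⟩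
      c₁ * toℚ (gauss q (suc r′)) + c₂ * toℚ (q ^ r′)
        ≡⟨ cong₂ _+_ c₁[r]≡1 c₂q^r′≡-1 ⟩
      1ℚ - 1ℚ
        ≡⟨ ℚ.+-inverseʳ 1ℚ ⟩
      0ℚ ∎
      where open ≡-Reasoning

    e-value : ∀ x → ¬ x ≋ 0v → eL w x ≡ lincombL hyperplaneIndicator coefficients x
    e-value x x≉0 = sym (trans (coefficients-value x) (by-position (memb x us) refl))
      where
      coordinates≉0 : ∀ {y} → lincomb y us ≋ x → ¬ y ≋ 0v
      coordinates≉0 {y} y-ok y≋0 = x≉0 (≋-trans (≋-sym y-ok) (≋-trans (lincomb-cong us y≋0) (lincomb-0v us)))
      by-position : ∀ b → memb x us ≡ b →
                    c₁ * toℚ (#through (ℋ) x) + c₂ * toℚ (#through (𝒢) x) ≡ eL w x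
      by-position false x∉U = begin
        c₁ * toℚ (#through (ℋ) x) + c₂ * toℚ (#through (𝒢) x)
          ≡⟨ cong₂ (λ a b → c₁ * toℚ a + c₂ * toℚ b)
                     (#through-outside (ℋ) x∉U) (#through-outside (𝒢) x∉U) ⟩
        c₁ * toℚ 0 + c₂ * toℚ 0
          ≡⟨ cong₂ _+_ (c·0≡0 c₁) (c·0≡0 c₂) ⟩
        0ℚ + 0ℚ
          ≡⟨ ℚ.+-identityʳ 0ℚ ⟩
        0ℚ
          ≡⟨ cong 𝟙ℚ (sym (memb-w-outside x∉U)) ⟩
        eL w x ∎
        where open ≡-Reasoning
      by-position true x∈U with memb-sound x us x∈U
      ... | y₀ ∷ y , y-ok = begin
        c₁ * toℚ (#through (ℋ) x) + c₂ * toℚ (#through (𝒢) x)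
          ≡⟨ cong₂ (λ a b → c₁ * toℚ a + c₂ * toℚ b)
                     (trans (#through-coordinates (ℋ) (y₀ ∷ y) y-ok)
                              (hyperplanes-through (suc r′) (y₀ ∷ y) (coordinates≉0 y-ok)))
                     (#through-coordinates (𝒢) (y₀ ∷ y) y-ok) ⟩
        c₁ * toℚ (gauss q (suc r′)) + c₂ * toℚ (count (λ H → memb (y₀ ∷ y) (proj₁ H)) (𝒢))
          ≡⟨ combination-in-U (coordinates≉0 y-ok) ⟩
        𝟙ℚ (does (y ≋? 0v))
          ≡⟨ cong 𝟙ℚ (sym (memb-w-coordinates y₀ y y-ok)) ⟩
        eL w x ∎
        where open ≡-Reasoning

  module _ {n′ k} (r′ : ℕ) (BF : Vec (Vec Carrier (suc n′)) k) (BF-indep : LinAlg.LinIndep K (suc n′) BF)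
           (bound : suc (suc r′ ℕ.+ k) ≤ suc n′) where
    open LinAlg K (suc n′) using (NonZero; Disjoint; InSpan; eL; pS; one; oneF;
                                  PGen; pIdx; oneIdx; EGen; eIdx; oneFIdx; P≡E)
    open LinesOutside BF

    e-InSpan-P : ∀ w → NonZero w → Disjoint (w ∷ []) BF → InSpan (PGen (suc r′) BF) (eL w)
    e-InSpan-P w w≢0 w∩F with extend-independent (suc r′) w bound w∷F-independent
      where
      w∉F : ¬ w ∈span BF
      w∉F (c , c-ok) = w≢0 (w∩F w (1# ∷ [] , Pointwise.lookup (≋-trans (+v-identityʳ _) (·-identityˡ w)))
                                  (c , Pointwise.lookup c-ok))
      w∷F-independent : Independent (w ∷ BF)
      w∷F-independent = independent-∷ w (LinIndep⇒Independent BF BF-indep) w∉F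
    ... | ts , indep = InSpan-trans hyperplaneIndicator (PGen (suc r′) BF)
            (λ H → indicator-InSpan-P (suc r′) BF (image us (proj₁ H)) (image-independent H) (image-disjoint H))
            (eL w) (coefficients , λ x x≢0 → e-value x (NonZero⇒≉0v x≢0))
      where open LineIndicator BF w ts indep

    P⊆E : ∀ i → InSpan (EGen BF) (PGen (suc r′) BF i)
    P⊆E (pIdx S _ S∩F) = InSpan-E (pS S) (toℚ (gauss q (suc r′))) (memb-lineConstant p S) on-F
      where
      p : Bool → ℚ
      p b = if b then (ℤ.+ gauss q (suc r′) ℚ./ 1) - (ℤ.+ gauss q (suc n′) ℚ./ 1) else (ℤ.+ gauss q (suc r′) ℚ./ 1)
      on-F : ∀ x → ¬ x ≋ 0v → memb x BF ≡ true → pS S x ≡ toℚ (gauss q (suc r′))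
      on-F x x≉0 x∈F = trans (cong p x∉S) (sym (toℚ-def _))
        where
        x∉S : memb x S ≡ false
        x∉S = ¬-not λ x∈S → x≉0 (≈v⇒≋ (S∩F x (Product.map₂ Pointwise.lookup (memb-sound x S x∈S))
                                             (Product.map₂ Pointwise.lookup (memb-sound x BF x∈F))))
    P⊆E oneIdx = InSpan-E one 1ℚ (λ _ _ _ _ → refl) (λ _ _ _ → refl)

    E⊆P : ∀ i → InSpan (PGen (suc r′) BF) (EGen BF i)
    E⊆P (eIdx w w≢0 w∩F) = e-InSpan-P w w≢0 w∩F
    E⊆P oneFIdx = InSpan-trans oneOrLine (PGen (suc r′) BF) oneOrLine⊆P (oneF BF) oneF-InSpan
      where
      oneOrLine⊆P : ∀ i → InSpan (PGen (suc r′) BF) (oneOrLine i)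
      oneOrLine⊆P (inj₁ tt)               = InSpan-gen (PGen (suc r′) BF) oneIdx
      oneOrLine⊆P (inj₂ (w , w≢0 , w∩F)) = e-InSpan-P w w≢0 w∩F

    P≡E-holds : P≡E (suc r′) BF
    P≡E-holds = InSpan-trans (PGen (suc r′) BF) (EGen BF) P⊆E , InSpan-trans (EGen BF) (PGen (suc r′) BF) E⊆P

open import Data.Nat using (_+_; _*_)

dimension-bound : ∀ {n r k} → 2 * r + 1 ≤ n → k ≤ r → suc (r + k) ≤ n
dimension-bound {n} {r} {k} 2r+1≤n k≤r = begin
  suc (r + k) ≤⟨ s≤s (ℕ.+-monoʳ-≤ r k≤r) ⟩
  suc (r + r) ≡⟨ ≡.cong (λ m → suc (r + m)) (≡.sym (ℕ.+-identityʳ r)) ⟩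
  suc (2 * r) ≡⟨ ℕ.+-comm 1 (2 * r) ⟩
  2 * r + 1   ≤⟨ 2r+1≤n ⟩
  n           ∎
  where open ℕ.≤-Reasoning

lemma3p15 : (K : FiniteField) (n r : ℕ) → 1 ≤ r → 2 * r + 1 ≤ n →
    (k : ℕ) → k ≤ r → (BF : Vec (LinAlg.V K n) k) → LinAlg.LinIndep K n BF →
    LinAlg.P≡E K n r BF
lemma3p15 K zero     (suc r′) _ () k k≤r BF BF-indep
lemma3p15 K (suc n′) (suc r′) _ 2r+1≤n k k≤r BF BF-indep =
  P≡E-holds K r′ BF BF-indep (dimension-bound 2r+1≤n k≤r)
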